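{- Let $n$ be a positive integer and let $1 \leq a_1 < \ldots < a_k \leq n$ be integers. Then $|S(a)| \leq (c_4 + o(1)) n^2$, where $c_4 = \frac{e^2-1}{2(e^2+1)}$ and $o(1)$ denotes a quantity depending only on $n$ that tends to $0$ as $n \to \infty$ (uniformly over all such sequences $a$).
   Context: For a finite sequence of integers $a = (a_i)_{1 \leq i \leq k}$, $S(a) = \{\sum_{i=u}^{v} a_i \mid 1 \leq u \leq v \leq k\}$ is the set of its consecutive sums. -}

module Defs where

open import Data.Nat as ℕ using (ℕ; zero; suc; _^_; _!)
open import Data.Nat.Properties using (_!≢0)
open import Data.Integer using (+_)
open import Data.List using (List; []; _∷_; _++_; map; length; deduplicate)
open import Data.Rational.Unnormalised using (ℚᵘ; _/_; _<_; _*_; _+_; _-_; 0ℚᵘ; 1ℚᵘ)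
open import Data.Product using (∃)

prefixSums : List ℕ → List ℕ
prefixSums []       = []
prefixSums (x ∷ xs) = x ∷ map (x ℕ.+_) (prefixSums xs)

consecSums : List ℕ → List ℕ
consecSums []       = []
consecSums (x ∷ xs) = prefixSums (x ∷ xs) ++ consecSums xs

-- |S(a)| : the number of distinct consecutive sums.
cardS : List ℕ → ℕ
cardS a = length (deduplicate ℕ._≟_ (consecSums a))

ℕ→ℚ : ℕ → ℚᵘ
ℕ→ℚ n = + n / 1

e²term : ℕ → ℚᵘ
e²term j = (+ (2 ^ j) / (j !)) {{j !≢0}}

e²partial : ℕ → ℚᵘ
e²partial zero    = e²term zero
e²partial (suc m) = e²partial m + e²term (suc m)

-- Rational upper bound for e²:  U_m = s_{m+2} + 2 · 2^{m+3}/(m+3)!.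
-- Valid since for j ≥ m+3 ≥ 3 consecutive terms have ratio 2/(j+1) ≤ 1/2,
-- so the tail Σ_{j ≥ m+3} 2^j/j! ≤ 2 · 2^{m+3}/(m+3)!.  U_m ↘ e² as m → ∞.
e²upper : ℕ → ℚᵘ
e²upper m = e²partial (suc (suc m)) + (ℕ→ℚ 2 * e²term (suc (suc (suc m))))

-- c₄ = (e² − 1) / (2(e² + 1)) is increasing in e², so
-- (U_m − 1)/(2(U_m + 1)) is a sequence of rational upper bounds decreasing to c₄.
-- "c₄ < q" (strict comparison of the real c₄ with a rational q) holds iff some such
-- upper bound is < q, i.e. (multiplying by 2(U_m + 1) > 0)  U_m − 1 < 2q(U_m + 1).
c₄<_ : ℚᵘ → Set
c₄< q = ∃ λ m → (e²upper m - 1ℚᵘ) < (ℕ→ℚ 2 * q) * (e²upper m + 1ℚᵘ)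

-- Fix a threshold X. The distinct consecutive sums number at most X + 1 plus the number of
-- windows (runs of consecutive terms) whose sum exceeds X. The i-th term from the end of an
-- increasing sequence in [1, N] is at most N + 1 - i, so each window is dominated by a window of
-- the same length of the staircase (1, 2, …, N). For a window length L there are thus at most
-- (S_L - X) / L offending windows, where S_L is the largest staircase window sum, and none once
-- S_L ≤ X.
-- With N = (A² + B²) t and X = 2A²B²t² this gives
--   4 |S| ≤ 4X (1 - H) + 2 (A² + B²) (B² - A²) t² + O(t),   H = Σ_{2A²t ≤ L < 2ABt} 1/L.
-- Since (B/A)² ≤ e^{2H} and e^y ≤ e² - 2 + y on [0, 2], we get 1 - H ≤ (e² - (B/A)²) / 2, so
-- with (B/A)² close to e² this leaves |S| ≤ ((B² - A²) / (2 (A² + B²)) + ε) n² ≈ c₄ n².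
-- Formally e² is replaced throughout by one of the rational upper bounds e²upper m.

module Submission where

open import Data.Nat.Base as ℕ using (ℕ)
import Data.Nat.Properties as ℕ
open import Data.Nat.Tactic.RingSolver using () renaming (ring to ℕ-ring)
open import Data.Product using (∃; _×_; _,_)
open import Data.Rational.Unnormalised.Base as Q using (ℚᵘ)
open import Relation.Binary.PropositionalEquality using (_≡_)
open import Relation.Nullary using (Dec; yes; no; ¬_)
open import Tactic.RingSolver using (solve-∀)
open import Defs using (prefixSums; consecSums; cardS; ℕ→ℚ; e²term; e²partial; e²upper; c₄<_)

last-before-failure : ∀ {p} {P : ℕ → Set p} → (∀ b → Dec (P b)) → ∀ s → P 0 → ¬ P (ℕ.suc s) →
                      ∃ λ b → b ℕ.≤ s × P b × ¬ P (ℕ.suc b)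
last-before-failure P? ℕ.zero    P0 ¬P1 = 0 , ℕ.z≤n , P0 , ¬P1
last-before-failure P? (ℕ.suc s) P0 ¬P2+s with P? (ℕ.suc s)
... | yes P1+s = ℕ.suc s , ℕ.≤-refl , P1+s , ¬P2+s
... | no ¬P1+s with last-before-failure P? s P0 ¬P1+s
...   | b , b≤s , Pb , ¬P1+b = b , ℕ.m≤n⇒m≤1+n b≤s , Pb , ¬P1+b


module Sum where

  open import Data.List.Base using (applyUpTo)
  open import Data.Nat.Base
  open import Data.Nat.ListAction using (sum)
  open import Data.Nat.Properties
  open import Algebra.Properties.CommutativeSemigroup +-commutativeSemigroup using (interchange)
  open import Function.Base using (_∘_)
  open import Relation.Binary.PropositionalEquality

  ∑< : ℕ → (ℕ → ℕ) → ℕ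
  ∑< n f = sum (applyUpTo f n)

  syntax ∑< n (λ i → e) = ∑[ i < n ] e

  ∑-cong : ∀ n {f g : ℕ → ℕ} → (∀ i → i < n → f i ≡ g i) → ∑< n f ≡ ∑< n g
  ∑-cong zero    eq = refl
  ∑-cong (suc n) eq = cong₂ _+_ (eq 0 z<s) (∑-cong n (λ i i<n → eq (suc i) (s<s i<n)))

  ∑-mono-≤ : ∀ n {f g : ℕ → ℕ} → (∀ i → i < n → f i ≤ g i) → ∑< n f ≤ ∑< n g
  ∑-mono-≤ zero    le = z≤n
  ∑-mono-≤ (suc n) le = +-mono-≤ (le 0 z<s) (∑-mono-≤ n (λ i i<n → le (suc i) (s<s i<n)))

  ∑-distrib-+ : ∀ n (f g : ℕ → ℕ) → ∑[ i < n ] (f i + g i) ≡ ∑< n f + ∑< n g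
  ∑-distrib-+ zero    f g = refl
  ∑-distrib-+ (suc n) f g = trans (cong (f 0 + g 0 +_) (∑-distrib-+ n (f ∘ suc) (g ∘ suc)))
                                  (interchange (f 0) (g 0) _ _)

  ∑-*ˡ : ∀ n c (f : ℕ → ℕ) → ∑[ i < n ] (c * f i) ≡ c * ∑< n f
  ∑-*ˡ zero    c f = sym (*-zeroʳ c)
  ∑-*ˡ (suc n) c f = trans (cong (c * f 0 +_) (∑-*ˡ n c (f ∘ suc))) (sym (*-distribˡ-+ c (f 0) _))

  ∑-const : ∀ n c → ∑[ _ < n ] c ≡ n * c
  ∑-const zero    c = refl
  ∑-const (suc n) c = cong (c +_) (∑-const n c)

  ∑-zero : ∀ n {f : ℕ → ℕ} → (∀ i → i < n → f i ≡ 0) → ∑< n f ≡ 0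
  ∑-zero n eq = trans (∑-cong n eq) (trans (∑-const n 0) (*-zeroʳ n))

  ∑-split : ∀ m n (f : ℕ → ℕ) → ∑< (m + n) f ≡ ∑< m f + ∑[ i < n ] f (m + i)
  ∑-split zero    n f = refl
  ∑-split (suc m) n f = trans (cong (f 0 +_) (∑-split m n (f ∘ suc))) (sym (+-assoc (f 0) _ _))

  ∑-last : ∀ n (f : ℕ → ℕ) → ∑< (suc n) f ≡ ∑< n f + f n
  ∑-last zero    f = +-comm (f 0) 0
  ∑-last (suc n) f = trans (cong (f 0 +_) (∑-last n (f ∘ suc))) (sym (+-assoc (f 0) _ _))

  ∑-countdown : ∀ k → 2 * ∑[ r < k ] (k ∸ r) ≡ k * suc k
  ∑-countdown zero    = refl
  ∑-countdown (suc k) = begin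
    2 * (suc k + ∑[ r < k ] (k ∸ r)) ≡⟨ *-distribˡ-+ 2 (suc k) _ ⟩
    2 * suc k + 2 * ∑[ r < k ] (k ∸ r) ≡⟨ cong (2 * suc k +_) (∑-countdown k) ⟩
    2 * suc k + k * suc k              ≡⟨ *-distribʳ-+ (suc k) 2 k ⟨
    (2 + k) * suc k                    ≡⟨ *-comm (2 + k) (suc k) ⟩
    suc k * suc (suc k)                ∎
    where open ≡-Reasoning

  ∑-triangle-swap : ∀ n (F : ℕ → ℕ → ℕ) →
    ∑[ a < n ] ∑[ b < n ∸ a ] F a b ≡ ∑[ b < n ] ∑[ a < n ∸ b ] F a b
  ∑-triangle-swap zero    F = refl
  ∑-triangle-swap (suc n) F = begin
    ∑< (suc n) (F 0) + ∑[ a < n ] ∑[ b < n ∸ a ] F (suc a) b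
      ≡⟨ cong (∑< (suc n) (F 0) +_) (∑-triangle-swap n (F ∘ suc)) ⟩
    ∑< (suc n) (F 0) + ∑< n G
      ≡⟨ cong (∑< (suc n) (F 0) +_) G-last ⟨
    ∑< (suc n) (F 0) + ∑< (suc n) G
      ≡⟨ ∑-distrib-+ (suc n) (F 0) G ⟨
    ∑[ b < suc n ] (F 0 b + G b)
      ≡⟨ ∑-cong (suc n) (λ b b<1+n → cong (λ k → ∑[ a < k ] F a b) (+-∸-assoc 1 (s≤s⁻¹ b<1+n))) ⟨
    ∑[ b < suc n ] ∑[ a < suc n ∸ b ] F a b ∎
    where
    open ≡-Reasoning
    G : ℕ → ℕ
    G b = ∑[ a < n ∸ b ] F (suc a) b
    G-last : ∑< (suc n) G ≡ ∑< n G
    G-last = begin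
      ∑< (suc n) G                           ≡⟨ ∑-last n G ⟩
      ∑< n G + ∑[ a < n ∸ n ] F (suc a) n    ≡⟨ cong (λ k → ∑< n G + ∑[ a < k ] F (suc a) n) (n∸n≡0 n) ⟩
      ∑< n G + 0                             ≡⟨ +-identityʳ _ ⟩
      ∑< n G                                 ∎


module Counting where

  open import Data.Bool.Base using (true; false)
  open import Data.List.Base using (List; []; _∷_; _++_; map; length; filter; deduplicate; applyUpTo)
  open import Data.List.Properties using (map-cong; map-++; map-applyUpTo)
  open import Data.List.Relation.Binary.Pointwise using (Pointwise; []; _∷_)
  open import Data.List.Relation.Unary.All using (All; []; _∷_)
  open import Data.List.Relation.Unary.Unique.Propositional using (Unique; []; _∷_)
  open import Data.Nat.Base
  open import Data.Nat.ListAction using (sum)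
  open import Data.Nat.ListAction.Properties using (sum-++)
  open import Data.Nat.Properties
  open import Function.Base using (_∘′_)
  open import Data.List.Relation.Unary.Unique.DecPropositional.Properties _≟_ using (deduplicate-!)
  open import Algebra.Properties.CommutativeSemigroup +-commutativeSemigroup using (interchange)
  open import Relation.Binary.PropositionalEquality
  open import Relation.Nullary using (Dec; yes; no; does; ¬_)
  open import Relation.Nullary.Negation using (contradiction)
  import Relation.Unary as U
  open Sum

  𝟙 : ∀ {p} {P : Set p} → Dec P → ℕ
  𝟙 (yes _) = 1
  𝟙 (no _)  = 0

  𝟙-yes : ∀ {p} {P : Set p} (P? : Dec P) → P → 𝟙 P? ≡ 1
  𝟙-yes (yes _) _ = refl
  𝟙-yes (no ¬p) p = contradiction p ¬p

  𝟙-no : ∀ {p} {P : Set p} (P? : Dec P) → ¬ P → 𝟙 P? ≡ 0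
  𝟙-no (yes p) ¬p = contradiction p ¬p
  𝟙-no (no _)  _  = refl

  𝟙≤1 : ∀ {p} {P : Set p} (P? : Dec P) → 𝟙 P? ≤ 1
  𝟙≤1 (yes _) = ≤-refl
  𝟙≤1 (no _)  = z≤n

  sum-map-+ : ∀ (f g : ℕ → ℕ) xs → sum (map (λ x → f x + g x) xs) ≡ sum (map f xs) + sum (map g xs)
  sum-map-+ f g []       = refl
  sum-map-+ f g (x ∷ xs) = trans (cong (f x + g x +_) (sum-map-+ f g xs)) (interchange (f x) (g x) _ _)

  sum-map-filter : ∀ (f : ℕ → ℕ) {p} {P : U.Pred ℕ p} (P? : U.Decidable P) xs →
                   sum (map f (filter P? xs)) ≤ sum (map f xs)
  sum-map-filter f P? []       = z≤n
  sum-map-filter f P? (x ∷ xs) with does (P? x)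
  ... | true  = +-monoʳ-≤ (f x) (sum-map-filter f P? xs)
  ... | false = ≤-trans (sum-map-filter f P? xs) (m≤n+m _ (f x))

  length≡sum-map-1 : ∀ (xs : List ℕ) → length xs ≡ sum (map (λ _ → 1) xs)
  length≡sum-map-1 []       = refl
  length≡sum-map-1 (x ∷ xs) = cong suc (length≡sum-map-1 xs)

  countAbove : ℕ → List ℕ → ℕ
  countAbove X xs = sum (map (λ v → 𝟙 (X <? v)) xs)

  countBelow : ℕ → List ℕ → ℕ
  countBelow Y xs = sum (map (λ v → 𝟙 (v <? Y)) xs)

  count≡ : ℕ → List ℕ → ℕ
  count≡ Y xs = sum (map (λ v → 𝟙 (v ≟ Y)) xs)

  count≡-unique : ∀ Y {xs} → Unique xs → count≡ Y xs ≤ 1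
  count≡-unique Y {[]}     []           = z≤n
  count≡-unique Y {v ∷ vs} (v∉vs ∷ !vs) with v ≟ Y
  ... | yes refl = ≤-reflexive (cong suc (absent v∉vs))
    where
    absent : ∀ {ws} → All (v ≢_) ws → count≡ v ws ≡ 0
    absent []           = refl
    absent (v≢w ∷ v∉ws) = cong₂ _+_ (𝟙-no (_ ≟ v) (v≢w ∘′ sym)) (absent v∉ws)
  ... | no _     = count≡-unique Y !vs

  countBelow-unique : ∀ Y {xs} → Unique xs → countBelow Y xs ≤ Y
  countBelow-unique zero    {xs} _   = ≤-reflexive (nothing-below xs)
    where
    nothing-below : ∀ ws → countBelow 0 ws ≡ 0
    nothing-below []       = refl
    nothing-below (w ∷ ws) = nothing-below ws
  countBelow-unique (suc Y) {xs} !xs = begin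
    countBelow (suc Y) xs          ≡⟨ cong sum (map-cong split xs) ⟩
    sum (map (λ v → 𝟙 (v <? Y) + 𝟙 (v ≟ Y)) xs) ≡⟨ sum-map-+ _ _ xs ⟩
    countBelow Y xs + count≡ Y xs  ≤⟨ +-mono-≤ (countBelow-unique Y !xs) (count≡-unique Y !xs) ⟩
    Y + 1                          ≡⟨ +-comm Y 1 ⟩
    suc Y                          ∎
    where
    open ≤-Reasoning
    split : ∀ v → 𝟙 (v <? suc Y) ≡ 𝟙 (v <? Y) + 𝟙 (v ≟ Y)
    split v with v <? suc Y | v <? Y | v ≟ Y
    ... | yes _      | yes _   | no _     = refl
    ... | yes _      | no _    | yes _    = refl
    ... | no _       | no _    | no _     = refl
    ... | yes v<1+Y  | no v≮Y  | no v≢Y   = contradiction (≤∧≢⇒< (s≤s⁻¹ v<1+Y) v≢Y) v≮Y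
    ... | _          | yes v<Y | yes refl = contradiction v<Y (<-irrefl refl)
    ... | no v≮1+Y   | yes v<Y | _        = contradiction (m<n⇒m<1+n v<Y) v≮1+Y
    ... | no v≮1+Y   | _       | yes refl = contradiction (n<1+n v) v≮1+Y

  length≡countBelow+countAbove : ∀ X xs → length xs ≡ countBelow (suc X) xs + countAbove X xs
  length≡countBelow+countAbove X xs =
    trans (length≡sum-map-1 xs) (trans (cong sum (map-cong below-or-above xs)) (sum-map-+ _ _ xs))
    where
    below-or-above : ∀ v → 1 ≡ 𝟙 (v <? suc X) + 𝟙 (X <? v)
    below-or-above v with v <? suc X | X <? v
    ... | yes _   | no _    = refl
    ... | no _    | yes _   = refl
    ... | yes v≤X | yes X<v = contradiction (s≤s⁻¹ v≤X) (<⇒≱ X<v)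
    ... | no v≰X  | no X≮v  = contradiction (s≤s (≮⇒≥ X≮v)) v≰X

  countAbove-deduplicate : ∀ X xs → countAbove X (deduplicate _≟_ xs) ≤ countAbove X xs
  countAbove-deduplicate X []       = z≤n
  countAbove-deduplicate X (x ∷ xs) = +-monoʳ-≤ (𝟙 (X <? x))
    (≤-trans (sum-map-filter _ _ (deduplicate _≟_ xs)) (countAbove-deduplicate X xs))

  length-deduplicate≤ : ∀ X xs → length (deduplicate _≟_ xs) ≤ suc X + countAbove X xs
  length-deduplicate≤ X xs = begin
    length D                              ≡⟨ length≡countBelow+countAbove X D ⟩
    countBelow (suc X) D + countAbove X D ≤⟨ +-mono-≤ (countBelow-unique (suc X) (deduplicate-! xs))
                                                       (countAbove-deduplicate X xs) ⟩
    suc X + countAbove X xs               ∎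
    where
    open ≤-Reasoning
    D = deduplicate _≟_ xs

  countAbove-++ : ∀ X xs ys → countAbove X (xs ++ ys) ≡ countAbove X xs + countAbove X ys
  countAbove-++ X xs ys = trans (cong sum (map-++ _ xs ys)) (sum-++ (map _ xs) _)

  countAbove-applyUpTo : ∀ X (f : ℕ → ℕ) m → countAbove X (applyUpTo f m) ≡ ∑[ i < m ] 𝟙 (X <? f i)
  countAbove-applyUpTo X f m = cong sum (map-applyUpTo f _ m)

  𝟙<-mono : ∀ X {v w} → v ≤ w → 𝟙 (X <? v) ≤ 𝟙 (X <? w)
  𝟙<-mono X {v} {w} v≤w with X <? v
  ... | yes X<v = ≤-reflexive (sym (𝟙-yes (X <? w) (<-≤-trans X<v v≤w)))
  ... | no _    = z≤n

  countAbove-mono : ∀ X {xs ys} → Pointwise _≤_ xs ys → countAbove X xs ≤ countAbove X ys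
  countAbove-mono X []         = z≤n
  countAbove-mono X (v≤w ∷ le) = +-mono-≤ (𝟙<-mono X v≤w) (countAbove-mono X le)


module Windows where

  open import Data.List.Base using (List; []; _∷_; _++_; map; length; applyUpTo)
  open import Data.List.Properties using (map-applyUpTo)
  open import Data.List.Relation.Binary.Pointwise using (Pointwise; []; _∷_)
  open import Data.List.Relation.Unary.All using (All; []; _∷_)
  import Data.List.Relation.Unary.All as All
  open import Data.List.Relation.Unary.AllPairs using (AllPairs; []; _∷_)
  open import Data.Nat.Base
  open import Data.Nat.Properties
  open import Data.Product using (_×_; proj₁; proj₂)
  open import Function.Base using (_∘_)
  open import Relation.Binary.PropositionalEquality
  open import Relation.Nullary using (yes; no)
  open Sum
  open Counting

  stair : ℕ → ℕ → ℕ
  stair c zero    = c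
  stair c (suc ℓ) = c + stair (suc c) ℓ

  stair-suc : ∀ c ℓ → stair (suc c) ℓ ≡ stair c ℓ + suc ℓ
  stair-suc c zero    = +-comm 1 c
  stair-suc c (suc ℓ) = begin
    suc c + stair (suc (suc c)) ℓ      ≡⟨ cong (suc c +_) (stair-suc (suc c) ℓ) ⟩
    suc c + (stair (suc c) ℓ + suc ℓ)  ≡⟨ shuffle c (stair (suc c) ℓ) ℓ ⟩
    c + stair (suc c) ℓ + suc (suc ℓ)  ∎
    where
    open ≡-Reasoning
    shuffle : ∀ c s ℓ → suc c + (s + suc ℓ) ≡ c + s + suc (suc ℓ)
    shuffle = solve-∀ ℕ-ring

  stair-monoˡ-≤ : ∀ ℓ {c d} → c ≤ d → stair c ℓ ≤ stair d ℓ
  stair-monoˡ-≤ zero    c≤d = c≤d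
  stair-monoˡ-≤ (suc ℓ) c≤d = +-mono-≤ c≤d (stair-monoˡ-≤ ℓ (s≤s c≤d))

  stair-closed : ∀ c ℓ → 2 * stair c ℓ ≡ suc ℓ * (2 * c + ℓ)
  stair-closed c zero    = sym (trans (+-identityʳ _) (+-identityʳ _))
  stair-closed c (suc ℓ) = begin
    2 * (c + stair (suc c) ℓ)          ≡⟨ *-distribˡ-+ 2 c _ ⟩
    2 * c + 2 * stair (suc c) ℓ        ≡⟨ cong (2 * c +_) (stair-closed (suc c) ℓ) ⟩
    2 * c + suc ℓ * (2 * suc c + ℓ)    ≡⟨ step c ℓ ⟩
    suc (suc ℓ) * (2 * c + suc ℓ)      ∎
    where
    open ≡-Reasoning
    step : ∀ c ℓ → 2 * c + suc ℓ * (2 * suc c + ℓ) ≡ suc (suc ℓ) * (2 * c + suc ℓ)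
    step = solve-∀ ℕ-ring

  head+length≤ : ∀ {n} x xs → AllPairs _<_ (x ∷ xs) → All (_≤ n) (x ∷ xs) → x + length xs ≤ n
  head+length≤ x []       _                  (x≤n ∷ _)  = ≤-trans (≤-reflexive (+-identityʳ x)) x≤n
  head+length≤ x (y ∷ ys) ((x<y ∷ _) ∷ <ys) (_ ∷ ≤ys) = begin
    x + suc (length ys) ≡⟨ +-suc x _ ⟩
    suc x + length ys   ≤⟨ +-monoˡ-≤ _ x<y ⟩
    y + length ys       ≤⟨ head+length≤ y ys <ys ≤ys ⟩
    _                   ∎
    where open ≤-Reasoning

  length≤bound : ∀ {n} xs → AllPairs _<_ xs → All (λ x → 1 ≤ x × x ≤ n) xs → length xs ≤ n
  length≤bound []       _   _              = z≤n
  length≤bound (x ∷ xs) <xs bounds@(x≥1 ∷ _) =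
    ≤-trans (+-monoˡ-≤ (length xs) (proj₁ x≥1)) (head+length≤ x xs <xs (All.map proj₂ bounds))

  map-+-mono : ∀ {x c xs ys} → x ≤ c → Pointwise _≤_ xs ys → Pointwise _≤_ (map (x +_) xs) (map (c +_) ys)
  map-+-mono x≤c []         = []
  map-+-mono x≤c (v≤w ∷ le) = +-mono-≤ x≤c v≤w ∷ map-+-mono x≤c le

  prefixSums≤stairs : ∀ {n} c b → AllPairs _<_ b → All (_≤ n) b → c + length b ≡ suc n →
                      Pointwise _≤_ (prefixSums b) (applyUpTo (stair c) (length b))
  prefixSums≤stairs c []       _              _          _   = []
  prefixSums≤stairs c (x ∷ xs) <b@(_ ∷ <xs) ≤b@(_ ∷ ≤xs) len =
    x≤c ∷ subst (Pointwise _≤_ _) (map-applyUpTo (stair (suc c)) (c +_) (length xs))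
                (map-+-mono x≤c (prefixSums≤stairs (suc c) xs <xs ≤xs (trans (sym (+-suc c _)) len)))
    where
    x≤c : x ≤ c
    x≤c = +-cancelʳ-≤ (length xs) x c
            (≤-trans (head+length≤ x xs <b ≤b) (≤-reflexive (suc-injective (trans (sym len) (+-suc c _)))))

  exceeds : ℕ → ℕ → ℕ → ℕ
  exceeds X j ℓ = 𝟙 (X <? stair (suc j) ℓ)

  -- The windows of length ℓ + 1 of (1, 2, …, N) with sum above X; every window of an increasing
  -- sequence in [1, N] is dominated by a different one of them (prefixSums≤stairs).
  stairsAbove : ℕ → ℕ → ℕ → ℕ
  stairsAbove N X ℓ = ∑[ j < N ∸ ℓ ] exceeds X j ℓ

  private
    row : ℕ → ℕ → ℕ → ℕ
    row N X j = ∑[ ℓ < N ∸ j ] exceeds X j ℓ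

  countAbove-consecSums≤rows : ∀ {N} X j a → AllPairs _<_ a → All (_≤ N) a → j + length a ≡ N →
                                countAbove X (consecSums a) ≤ ∑[ i < length a ] row N X (j + i)
  countAbove-consecSums≤rows         X j []       _              _              _   = z≤n
  countAbove-consecSums≤rows {N} X j (x ∷ xs) <a@(_ ∷ <xs) ≤a@(_ ∷ ≤xs) len = begin
    countAbove X (prefixSums (x ∷ xs) ++ consecSums xs)
      ≡⟨ countAbove-++ X (prefixSums (x ∷ xs)) _ ⟩
    countAbove X (prefixSums (x ∷ xs)) + countAbove X (consecSums xs)
      ≤⟨ +-mono-≤ first (countAbove-consecSums≤rows X (suc j) xs <xs ≤xs (trans (sym (+-suc j _)) len)) ⟩
    row N X j + ∑[ i < length xs ] row N X (suc j + i)
      ≡⟨ cong₂ _+_ (cong (row N X) (+-identityʳ j)) (∑-cong (length xs) (λ i _ → cong (row N X) (+-suc j i))) ⟨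
    ∑[ i < length (x ∷ xs) ] row N X (j + i) ∎
    where
    open ≤-Reasoning
    first : countAbove X (prefixSums (x ∷ xs)) ≤ row N X j
    first = begin
      countAbove X (prefixSums (x ∷ xs))
        ≤⟨ countAbove-mono X (prefixSums≤stairs (suc j) (x ∷ xs) <a ≤a (cong suc len)) ⟩
      countAbove X (applyUpTo (stair (suc j)) (length (x ∷ xs)))
        ≡⟨ countAbove-applyUpTo X (stair (suc j)) (length (x ∷ xs)) ⟩
      ∑[ ℓ < length (x ∷ xs) ] exceeds X j ℓ
        ≡⟨ cong (λ m → ∑[ ℓ < m ] exceeds X j ℓ) (trans (cong (_∸ j) (sym len)) (m+n∸m≡n j _)) ⟨
      row N X j ∎

  countAbove-consecSums≤ : ∀ N X a → AllPairs _<_ a → All (_≤ N) a → length a ≤ N →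
                           countAbove X (consecSums a) ≤ ∑[ ℓ < N ] stairsAbove N X ℓ
  countAbove-consecSums≤ N X a <a ≤a k≤N = begin
    countAbove X (consecSums a)                ≤⟨ countAbove-consecSums≤rows X j a <a ≤a j+k≡N ⟩
    ∑[ i < k ] row N X (j + i)                 ≤⟨ m≤n+m _ _ ⟩
    ∑< j (row N X) + ∑[ i < k ] row N X (j + i) ≡⟨ ∑-split j k (row N X) ⟨
    ∑< (j + k) (row N X)                       ≡⟨ cong (λ n → ∑< n (row N X)) j+k≡N ⟩
    ∑< N (row N X)                             ≡⟨ ∑-triangle-swap N (exceeds X) ⟩
    ∑[ ℓ < N ] stairsAbove N X ℓ               ∎
    where
    open ≤-Reasoning
    k = length a
    j = N ∸ k
    j+k≡N : j + k ≡ N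
    j+k≡N = m∸n+n≡m k≤N

  cardS≤ : ∀ {n} N X a → n ≤ N → AllPairs _<_ a → All (λ x → 1 ≤ x × x ≤ n) a →
           cardS a ≤ suc X + ∑[ ℓ < N ] stairsAbove N X ℓ
  cardS≤ N X a n≤N <a bounds = begin
    cardS a                              ≤⟨ length-deduplicate≤ X (consecSums a) ⟩
    suc X + countAbove X (consecSums a)  ≤⟨ +-monoʳ-≤ (suc X) (countAbove-consecSums≤ N X a <a ≤N k≤N) ⟩
    suc X + ∑[ ℓ < N ] stairsAbove N X ℓ ∎
    where
    open ≤-Reasoning
    ≤N : All (_≤ N) a
    ≤N = All.map (λ b → ≤-trans (proj₂ b) n≤N) bounds
    k≤N : length a ≤ N
    k≤N = ≤-trans (length≤bound a <a bounds) n≤N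

  progression-countAbove : ∀ d (f : ℕ → ℕ) → (∀ j → f (suc j) ≡ f j + d) →
                           ∀ M B → B ≤ f M → d * ∑[ j < M ] 𝟙 (B <? f j) + B ≤ f M
  progression-countAbove d f step zero    B B≤f0 = ≤-trans (≤-reflexive (cong (_+ B) (*-zeroʳ d))) B≤f0
  progression-countAbove d f step (suc M) B B≤fM with B <? f 0
  ... | yes B<f0 = begin
    d * (1 + ∑[ j < M ] 𝟙 (B <? f (suc j))) + B ≤⟨ +-mono-≤ (*-monoʳ-≤ d count≤) (<⇒≤ B<f0) ⟩
    d * suc M + f 0                             ≡⟨ +-comm (d * suc M) (f 0) ⟩
    f 0 + d * suc M                             ≡⟨ closed (suc M) ⟨
    f (suc M)                                   ∎
    where
    open ≤-Reasoning
    count≤ : 1 + ∑[ j < M ] 𝟙 (B <? f (suc j)) ≤ suc M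
    count≤ = s≤s (≤-trans (∑-mono-≤ M (λ j _ → 𝟙≤1 _)) (≤-reflexive (trans (∑-const M 1) (*-identityʳ M))))
    closed : ∀ m → f m ≡ f 0 + d * m
    closed zero    = sym (trans (cong (f 0 +_) (*-zeroʳ d)) (+-identityʳ (f 0)))
    closed (suc m) = begin-equality
      f (suc m)         ≡⟨ step m ⟩
      f m + d           ≡⟨ cong (_+ d) (closed m) ⟩
      f 0 + d * m + d   ≡⟨ +-assoc (f 0) (d * m) d ⟩
      f 0 + (d * m + d) ≡⟨ cong (f 0 +_) (trans (+-comm (d * m) d) (sym (*-suc d m))) ⟩
      f 0 + d * suc m   ∎
  ... | no _     = progression-countAbove d (f ∘ suc) (step ∘ suc) M B B≤fM

  stairsAbove≤width : ∀ N X ℓ → stairsAbove N X ℓ ≤ N ∸ ℓ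
  stairsAbove≤width N X ℓ = ≤-trans (∑-mono-≤ (N ∸ ℓ) (λ j _ → 𝟙≤1 _))
                                    (≤-reflexive (trans (∑-const (N ∸ ℓ) 1) (*-identityʳ (N ∸ ℓ))))

  stairsAbove-vanish : ∀ N X ℓ → stair (N ∸ ℓ) ℓ ≤ X → stairsAbove N X ℓ ≡ 0
  stairsAbove-vanish N X ℓ top≤X =
    ∑-zero (N ∸ ℓ) (λ j j<M → 𝟙-no _ (≤⇒≯ (≤-trans (stair-monoˡ-≤ ℓ j<M) top≤X)))

  stairsAbove-progression : ∀ N X ℓ → X ≤ stair (suc (N ∸ ℓ)) ℓ →
                            suc ℓ * stairsAbove N X ℓ + X ≤ stair (suc (N ∸ ℓ)) ℓ
  stairsAbove-progression N X ℓ =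
    progression-countAbove (suc ℓ) (λ j → stair (suc j) ℓ) (λ j → stair-suc (suc j) ℓ) (N ∸ ℓ) X


module Rational where

  open import Data.Integer.Base as ℤ using (ℤ; +_; +[1+_]; -[1+_])
  import Data.Integer.Properties as ℤ
  open import Data.Maybe.Base using (Maybe; just; nothing)
  open import Data.Nat.Base as ℕ using (ℕ; zero; suc)
  import Data.Nat.Properties as ℕ
  open import Data.Product using (∃; _,_)
  open import Data.Rational.Unnormalised.Base
  open import Data.Rational.Unnormalised.Properties
  open import Function.Base using (_∘_)
  open import Level using (0ℓ)
  open import Relation.Binary.PropositionalEquality using (refl; cong; cong₂; sym; trans)
  open import Relation.Nullary using (yes; no)
  open import Tactic.RingSolver.Core.AlmostCommutativeRing using (AlmostCommutativeRing; fromCommutativeRing)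
  open Sum using (∑<)

  ℚᵘ-ring : AlmostCommutativeRing 0ℓ 0ℓ
  ℚᵘ-ring = fromCommutativeRing +-*-commutativeRing is-zero
    where
    is-zero : ∀ p → Maybe (0ℚᵘ ≃ p)
    is-zero p with ↥ p ℤ.≟ ℤ.0ℤ
    ... | yes ↥p≡0 = just (≃-sym (↥p≡0⇒p≃0 p ↥p≡0))
    ... | no _     = nothing

  ℕ→ℚ-+ : ∀ m n → ℕ→ℚ (m ℕ.+ n) ≃ ℕ→ℚ m + ℕ→ℚ n
  ℕ→ℚ-+ m n = *≡* (cong (ℤ._* + 1) (trans (ℤ.pos-+ m n)
                 (sym (cong₂ ℤ._+_ (ℤ.*-identityʳ (+ m)) (ℤ.*-identityʳ (+ n))))))

  ℕ→ℚ-* : ∀ m n → ℕ→ℚ (m ℕ.* n) ≃ ℕ→ℚ m * ℕ→ℚ n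
  ℕ→ℚ-* m n = *≡* (cong (ℤ._* + 1) (ℤ.pos-* m n))

  ℕ→ℚ-mono-≤ : ∀ {m n} → m ℕ.≤ n → ℕ→ℚ m ≤ ℕ→ℚ n
  ℕ→ℚ-mono-≤ m≤n = *≤* (ℤ.*-monoʳ-≤-nonNeg (+ 1) (ℤ.+≤+ m≤n))

  ℕ→ℚ-mono-< : ∀ {m n} → m ℕ.< n → ℕ→ℚ m < ℕ→ℚ n
  ℕ→ℚ-mono-< {m} {n} m<n = *<* (ℤ.≤-<-trans (ℤ.≤-reflexive (ℤ.*-identityʳ (+ m)))
                               (ℤ.<-≤-trans (ℤ.+<+ m<n) (ℤ.≤-reflexive (sym (ℤ.*-identityʳ (+ n))))))

  ℕ→ℚ-cancel-≤ : ∀ {m n} → ℕ→ℚ m ≤ ℕ→ℚ n → m ℕ.≤ n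
  ℕ→ℚ-cancel-≤ {m} {n} m≤n with ℤ.≤-trans (ℤ.≤-reflexive (sym (ℤ.*-identityʳ (+ m))))
                                 (ℤ.≤-trans (drop-*≤* m≤n) (ℤ.≤-reflexive (ℤ.*-identityʳ (+ n))))
  ... | ℤ.+≤+ m≤n′ = m≤n′

  ℕ→ℚ-*-/ : ∀ n d .{{_ : ℕ.NonZero d}} → ℕ→ℚ d * (+ n / d) ≃ ℕ→ℚ n
  ℕ→ℚ-*-/ n (suc d) = *≡* (trans (ℤ.*-identityʳ _) (trans (ℤ.*-comm (+ suc d) (+ n))
                             (cong (λ k → + n ℤ.* + k) (sym (ℕ.*-identityˡ (suc d))))))

  0≤ℕ→ℚ : ∀ n → 0ℚᵘ ≤ ℕ→ℚ n
  0≤ℕ→ℚ n = ℕ→ℚ-mono-≤ ℕ.z≤n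

  0<ℕ→ℚ : ∀ {n} → 1 ℕ.≤ n → 0ℚᵘ < ℕ→ℚ n
  0<ℕ→ℚ (ℕ.s≤s _) = *<* (ℤ.+<+ (ℕ.s≤s ℕ.z≤n))

  p≤ℕ→ℚ∣↥p∣ : ∀ p → p ≤ ℕ→ℚ ℤ.∣ ↥ p ∣
  p≤ℕ→ℚ∣↥p∣ (mkℚᵘ (+ k) d) = *≤* (ℤ.≤-trans (ℤ.≤-reflexive (sym (ℤ.pos-* k 1)))
    (ℤ.≤-trans (ℤ.+≤+ (ℕ.*-monoʳ-≤ k (ℕ.s≤s ℕ.z≤n))) (ℤ.≤-reflexive (ℤ.pos-* k (suc d)))))
  p≤ℕ→ℚ∣↥p∣ (mkℚᵘ -[1+ k ] d) = *≤* ℤ.-≤+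

  0≤1/ℕ→ℚ-suc : ∀ k → 0ℚᵘ ≤ 1/ ℕ→ℚ (suc k)
  0≤1/ℕ→ℚ-suc k = *≤* (ℤ.+≤+ ℕ.z≤n)

  0≤1 : 0ℚᵘ ≤ 1ℚᵘ
  0≤1 = *≤* (ℤ.+≤+ ℕ.z≤n)

  archimedean : ∀ p → 0ℚᵘ < p → ∃ λ G → 1ℚᵘ ≤ p * ℕ→ℚ (suc G)
  archimedean (mkℚᵘ +[1+ k ] d) _ = d , *≤* (ℤ.+≤+ (ℕ.s≤s (ℕ.≤-trans
    (ℕ.≤-reflexive (trans (ℕ.+-identityʳ (d ℕ.* 1)) (ℕ.*-identityʳ d)))
    (ℕ.≤-trans (ℕ.m≤m+n d (k ℕ.* suc d)) (ℕ.≤-reflexive (sym (ℕ.*-identityʳ _)))))))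
  archimedean (mkℚᵘ (+ zero) d) (*<* (ℤ.+<+ ()))
  archimedean (mkℚᵘ -[1+ k ] d) (*<* ())

  *-monoʳ-≤′ : ∀ {r p q} → 0ℚᵘ ≤ r → p ≤ q → r * p ≤ r * q
  *-monoʳ-≤′ {r} 0≤r = *-monoʳ-≤-nonNeg r {{nonNegative 0≤r}}

  *-monoˡ-≤′ : ∀ {r p q} → 0ℚᵘ ≤ r → p ≤ q → p * r ≤ q * r
  *-monoˡ-≤′ {r} 0≤r = *-monoˡ-≤-nonNeg r {{nonNegative 0≤r}}

  *-mono-≤′ : ∀ {p q r s} → 0ℚᵘ ≤ p → 0ℚᵘ ≤ r → p ≤ q → r ≤ s → p * r ≤ q * s
  *-mono-≤′ 0≤p 0≤r p≤q r≤s = ≤-trans (*-monoˡ-≤′ 0≤r p≤q) (*-monoʳ-≤′ (≤-trans 0≤p p≤q) r≤s)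

  *-cancelˡ-≤′ : ∀ {r p q} → 0ℚᵘ < r → r * p ≤ r * q → p ≤ q
  *-cancelˡ-≤′ {r} 0<r = *-cancelˡ-≤-pos r {{positive 0<r}}

  p+q≤r⇒p≤r-q : ∀ {p q r} → p + q ≤ r → p ≤ r - q
  p+q≤r⇒p≤r-q {p} {q} {r} p+q≤r = ≤-trans (≤-reflexive (cancel p q)) (+-monoˡ-≤ (- q) p+q≤r)
    where
    cancel : ∀ p q → p ≃ (p + q) - q
    cancel = solve-∀ ℚᵘ-ring

  0<* : ∀ {p q} → 0ℚᵘ < p → 0ℚᵘ < q → 0ℚᵘ < p * q
  0<* {p} {q} 0<p 0<q = positive⁻¹ (p * q) {{pos*pos⇒pos p {{positive 0<p}} q {{positive 0<q}}}}

  *-cancelˡ-≃′ : ∀ {r p q} → 0ℚᵘ < r → r * p ≃ r * q → p ≃ q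
  *-cancelˡ-≃′ 0<r eq = ≤-antisym (*-cancelˡ-≤′ 0<r (≤-reflexive eq)) (*-cancelˡ-≤′ 0<r (≤-reflexive (≃-sym eq)))

  0≤* : ∀ {p q} → 0ℚᵘ ≤ p → 0ℚᵘ ≤ q → 0ℚᵘ ≤ p * q
  0≤* {p} {q} 0≤p 0≤q = ≤-trans (≤-reflexive (≃-sym (*-zeroˡ q))) (*-monoˡ-≤′ 0≤q 0≤p)

  p≤p+q′ : ∀ {p q} → 0ℚᵘ ≤ q → p ≤ p + q
  p≤p+q′ {p} {q} 0≤q = p≤p+q p q {{nonNegative 0≤q}}

  ∑ℚ< : ℕ → (ℕ → ℚᵘ) → ℚᵘ
  ∑ℚ< zero    f = 0ℚᵘ
  ∑ℚ< (suc n) f = f 0 + ∑ℚ< n (f ∘ suc)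

  syntax ∑ℚ< n (λ i → e) = ∑ℚ[ i < n ] e

  ∑ℚ-cong : ∀ n {f g : ℕ → ℚᵘ} → (∀ i → f i ≃ g i) → ∑ℚ< n f ≃ ∑ℚ< n g
  ∑ℚ-cong zero    eq = ≃-refl
  ∑ℚ-cong (suc n) eq = +-cong (eq 0) (∑ℚ-cong n (eq ∘ suc))

  ∑ℚ-mono-≤ : ∀ n {f g : ℕ → ℚᵘ} → (∀ i → i ℕ.< n → f i ≤ g i) → ∑ℚ< n f ≤ ∑ℚ< n g
  ∑ℚ-mono-≤ zero    le = ≤-refl
  ∑ℚ-mono-≤ (suc n) le = +-mono-≤ (le 0 ℕ.z<s) (∑ℚ-mono-≤ n (λ i i<n → le (suc i) (ℕ.s<s i<n)))

  ∑ℚ-distrib-+ : ∀ n (f g : ℕ → ℚᵘ) → ∑ℚ[ i < n ] (f i + g i) ≃ ∑ℚ< n f + ∑ℚ< n g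
  ∑ℚ-distrib-+ zero    f g = ≃-sym (+-identityʳ 0ℚᵘ)
  ∑ℚ-distrib-+ (suc n) f g = ≃-trans (+-congʳ (f 0 + g 0) (∑ℚ-distrib-+ n (f ∘ suc) (g ∘ suc)))
                                      (regroup (f 0) (g 0) _ _)
    where
    regroup : ∀ a b c d → (a + b) + (c + d) ≃ (a + c) + (b + d)
    regroup = solve-∀ ℚᵘ-ring

  ∑ℚ-*ˡ : ∀ n c (f : ℕ → ℚᵘ) → ∑ℚ[ i < n ] (c * f i) ≃ c * ∑ℚ< n f
  ∑ℚ-*ˡ zero    c f = ≃-sym (*-zeroʳ c)
  ∑ℚ-*ˡ (suc n) c f = ≃-trans (+-congʳ (c * f 0) (∑ℚ-*ˡ n c (f ∘ suc))) (≃-sym (*-distribˡ-+ c (f 0) _))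

  0≤∑ℚ : ∀ n {f : ℕ → ℚᵘ} → (∀ i → 0ℚᵘ ≤ f i) → 0ℚᵘ ≤ ∑ℚ< n f
  0≤∑ℚ zero    0≤f = ≤-refl
  0≤∑ℚ (suc n) 0≤f = ≤-trans (0≤f 0) (p≤p+q′ (0≤∑ℚ n (0≤f ∘ suc)))

  harmonic : ℕ → ℕ → ℚᵘ
  harmonic a k = ∑ℚ[ r < k ] (1/ ℕ→ℚ (suc (a ℕ.+ r)))

  0≤harmonic : ∀ a k → 0ℚᵘ ≤ harmonic a k
  0≤harmonic a k = 0≤∑ℚ k (λ r → 0≤1/ℕ→ℚ-suc (a ℕ.+ r))

  harmonic-suc : ∀ a k → harmonic a (suc k) ≃ 1/ ℕ→ℚ (suc a) + harmonic (suc a) k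
  harmonic-suc a k = +-cong (≃-reflexive (cong (λ b → 1/ ℕ→ℚ (suc b)) (ℕ.+-identityʳ a)))
                            (∑ℚ-cong k (λ r → ≃-reflexive (cong (λ b → 1/ ℕ→ℚ (suc b)) (ℕ.+-suc a r))))

  ℕ→ℚ-∑ : ∀ n (f : ℕ → ℕ) → ℕ→ℚ (∑< n f) ≃ ∑ℚ[ i < n ] ℕ→ℚ (f i)
  ℕ→ℚ-∑ zero    f = ≃-refl
  ℕ→ℚ-∑ (suc n) f = ≃-trans (ℕ→ℚ-+ (f 0) _) (+-congʳ (ℕ→ℚ (f 0)) (ℕ→ℚ-∑ n (f ∘ suc)))

  ℕ→ℚ-+-*-1/-≤ : ∀ d r x y → suc d ℕ.* r ℕ.+ x ℕ.≤ suc d ℕ.* y →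
                 ℕ→ℚ r + ℕ→ℚ x * 1/ ℕ→ℚ (suc d) ≤ ℕ→ℚ y
  ℕ→ℚ-+-*-1/-≤ d r x y le = *-cancelˡ-≤′ {L} (0<ℕ→ℚ (ℕ.s≤s ℕ.z≤n)) (begin
    L * (ℕ→ℚ r + ℕ→ℚ x * 1/ L)       ≃⟨ regroup L (ℕ→ℚ r) (ℕ→ℚ x) (1/ L) ⟩
    L * ℕ→ℚ r + ℕ→ℚ x * (L * 1/ L)   ≃⟨ +-congʳ (L * ℕ→ℚ r) (≃-trans (*-congˡ {ℕ→ℚ x} (*-inverseʳ L)) (*-identityʳ (ℕ→ℚ x))) ⟩
    L * ℕ→ℚ r + ℕ→ℚ x                ≃⟨ +-congˡ (ℕ→ℚ x) (ℕ→ℚ-* (suc d) r) ⟨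
    ℕ→ℚ (suc d ℕ.* r) + ℕ→ℚ x        ≃⟨ ℕ→ℚ-+ (suc d ℕ.* r) x ⟨
    ℕ→ℚ (suc d ℕ.* r ℕ.+ x)          ≤⟨ ℕ→ℚ-mono-≤ le ⟩
    ℕ→ℚ (suc d ℕ.* y)                ≃⟨ ℕ→ℚ-* (suc d) y ⟩
    L * ℕ→ℚ y                        ∎)
    where
    open ≤-Reasoning
    L = ℕ→ℚ (suc d)
    regroup : ∀ L r x i → L * (r + x * i) ≃ L * r + x * (L * i)
    regroup = solve-∀ ℚᵘ-ring


-- Window lengths ℓ + 1 ≤ a₁ contribute nothing, the next k₂ lengths are counted by the
-- progression bound, and the last k₃ lengths trivially.
module RangeSplit (a₁ k₂ k₃ X : ℕ) where

  open import Data.Nat.Base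
  open import Data.Nat.Properties
  open import Relation.Binary.PropositionalEquality
  open Sum
  open Windows

  N : ℕ
  N = a₁ + (k₂ + k₃)

  N∸middle : ∀ r → r ≤ k₂ → N ∸ (a₁ + r) ≡ (k₂ ∸ r) + k₃
  N∸middle r r≤k₂ = trans ([m+n]∸[m+o]≡n∸o a₁ (k₂ + k₃) r) (+-∸-comm k₃ r≤k₂)

  N∸tail : ∀ r → N ∸ (a₁ + (k₂ + r)) ≡ k₃ ∸ r
  N∸tail r = trans ([m+n]∸[m+o]≡n∸o a₁ (k₂ + k₃) (k₂ + r)) ([m+n]∸[m+o]≡n∸o k₂ k₃ r)

  ∑stairsAbove≤ : (∀ ℓ → ℓ < a₁ → stair (N ∸ ℓ) ℓ ≤ X) →
    ∑[ ℓ < N ] stairsAbove N X ℓ ≤ ∑[ r < k₂ ] stairsAbove N X (a₁ + r) + ∑[ r < k₃ ] (k₃ ∸ r)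
  ∑stairsAbove≤ short = begin
    ∑< N S
      ≡⟨ ∑-split a₁ (k₂ + k₃) S ⟩
    ∑< a₁ S + ∑[ i < k₂ + k₃ ] S (a₁ + i)
      ≡⟨ cong₂ _+_ (∑-zero a₁ (λ ℓ ℓ<a₁ → stairsAbove-vanish N X ℓ (short ℓ ℓ<a₁)))
                   (∑-split k₂ k₃ (λ i → S (a₁ + i))) ⟩
    ∑[ r < k₂ ] S (a₁ + r) + ∑[ r < k₃ ] S (a₁ + (k₂ + r))
      ≤⟨ +-monoʳ-≤ (∑[ r < k₂ ] S (a₁ + r))
           (∑-mono-≤ k₃ (λ r _ → ≤-trans (stairsAbove≤width N X (a₁ + (k₂ + r))) (≤-reflexive (N∸tail r)))) ⟩
    ∑[ r < k₂ ] S (a₁ + r) + ∑[ r < k₃ ] (k₃ ∸ r) ∎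
    where
    open ≤-Reasoning
    S = stairsAbove N X

  middleCap : ℕ → ℕ
  middleCap r = 2 * (2 * suc ((k₂ ∸ r) + k₃) + (a₁ + r))

  middle-term : ∀ r → r < k₂ → X ≤ stair (suc ((k₂ ∸ r) + k₃)) (a₁ + r) →
                suc (a₁ + r) * (4 * stairsAbove N X (a₁ + r)) + 4 * X ≤ suc (a₁ + r) * middleCap r
  middle-term r r<k₂ X≤stair = begin
    L * (4 * R) + 4 * X          ≡⟨ factor L R X ⟩
    4 * (L * R + X)              ≤⟨ *-monoʳ-≤ 4 (subst (λ M → L * stairsAbove N X ℓ + X ≤ stair (suc M) ℓ)
                                      (N∸middle r (<⇒≤ r<k₂)) (stairsAbove-progression N X ℓ X≤stair′)) ⟩
    4 * stair c ℓ                ≡⟨ *-assoc 2 2 (stair c ℓ) ⟩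
    2 * (2 * stair c ℓ)          ≡⟨ cong (2 *_) (stair-closed c ℓ) ⟩
    2 * (L * (2 * c + ℓ))        ≡⟨ regroup L (2 * c + ℓ) ⟩
    L * middleCap r              ∎
    where
    open ≤-Reasoning
    ℓ = a₁ + r
    L = suc ℓ
    c = suc ((k₂ ∸ r) + k₃)
    R = stairsAbove N X ℓ
    X≤stair′ : X ≤ stair (suc (N ∸ ℓ)) ℓ
    X≤stair′ = subst (λ M → X ≤ stair (suc M) ℓ) (sym (N∸middle r (<⇒≤ r<k₂))) X≤stair
    factor : ∀ L R X → L * (4 * R) + 4 * X ≡ 4 * (L * R + X)
    factor = solve-∀ ℕ-ring
    regroup : ∀ L t → 2 * (L * t) ≡ L * (2 * t)
    regroup = solve-∀ ℕ-ring

  ∑middleCap≡ : ∑< k₂ middleCap ≡ 3 * (k₂ * k₂) + k₂ + 2 * k₂ * (2 * k₃ + a₁ + 2)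
  ∑middleCap≡ = begin
    ∑< k₂ middleCap                                    ≡⟨ ∑-cong k₂ middleCap≡ ⟩
    ∑[ r < k₂ ] (2 * (k₂ ∸ r) + 2 * (k₂ + c))          ≡⟨ ∑-distrib-+ k₂ (λ r → 2 * (k₂ ∸ r)) (λ _ → 2 * (k₂ + c)) ⟩
    ∑[ r < k₂ ] (2 * (k₂ ∸ r)) + ∑[ _ < k₂ ] (2 * (k₂ + c))
      ≡⟨ cong₂ _+_ (trans (∑-*ˡ k₂ 2 (k₂ ∸_)) (∑-countdown k₂)) (∑-const k₂ (2 * (k₂ + c))) ⟩
    k₂ * suc k₂ + k₂ * (2 * (k₂ + c))                  ≡⟨ expand k₂ c ⟩
    3 * (k₂ * k₂) + k₂ + 2 * k₂ * c                    ∎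
    where
    open ≡-Reasoning
    c = 2 * k₃ + a₁ + 2
    middleCap≡ : ∀ r → r < k₂ → middleCap r ≡ 2 * (k₂ ∸ r) + 2 * (k₂ + c)
    middleCap≡ r r<k₂ = begin
      middleCap r                                 ≡⟨ regroup (k₂ ∸ r) r k₃ a₁ ⟩
      2 * (k₂ ∸ r) + 2 * ((k₂ ∸ r) + r + c)       ≡⟨ cong (λ k → 2 * (k₂ ∸ r) + 2 * (k + c)) (m∸n+n≡m (<⇒≤ r<k₂)) ⟩
      2 * (k₂ ∸ r) + 2 * (k₂ + c)                 ∎
      where
      regroup : ∀ d r k a → 2 * (2 * suc (d + k) + (a + r)) ≡ 2 * d + 2 * (d + r + (2 * k + a + 2))
      regroup = solve-∀ ℕ-ring
    expand : ∀ k c → k * suc k + k * (2 * (k + c)) ≡ 3 * (k * k) + k + 2 * k * c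
    expand = solve-∀ ℕ-ring

  lowerOrder : ℕ
  lowerOrder = 4 + (3 * (k₂ * k₂) + k₂ + 2 * k₂ * (2 * k₃ + a₁ + 2)) + 2 * (k₃ * suc k₃)

  ∑middleCap+rest≡ : ∑< k₂ middleCap + (4 * suc X + 4 * ∑[ r < k₃ ] (k₃ ∸ r)) ≡ 4 * X + lowerOrder
  ∑middleCap+rest≡ = begin
    ∑< k₂ middleCap + (4 * suc X + 4 * ∑[ r < k₃ ] (k₃ ∸ r))
      ≡⟨ cong₂ (λ m t → m + (4 * suc X + t)) ∑middleCap≡ (trans (*-assoc 2 2 (∑[ r < k₃ ] (k₃ ∸ r))) (cong (2 *_) (∑-countdown k₃))) ⟩
    P + (4 * suc X + 2 * (k₃ * suc k₃))
      ≡⟨ regroup P X (k₃ * suc k₃) ⟩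
    4 * X + (4 + P + 2 * (k₃ * suc k₃)) ∎
    where
    open ≡-Reasoning
    P = 3 * (k₂ * k₂) + k₂ + 2 * k₂ * (2 * k₃ + a₁ + 2)
    regroup : ∀ P X t → P + (4 * suc X + 2 * t) ≡ 4 * X + (4 + P + 2 * t)
    regroup = solve-∀ ℕ-ring


module Estimate (a₁ k₂ k₃ X : ℕ) where

  open import Data.List.Base using (List)
  open import Data.List.Relation.Unary.All using (All)
  open import Data.List.Relation.Unary.AllPairs using (AllPairs)
  open import Data.Nat.Base as ℕ using (suc; _∸_)
  import Data.Nat.Properties as ℕ
  open import Data.Product using (_×_)
  open import Data.Rational.Unnormalised.Base
  open import Data.Rational.Unnormalised.Properties
  open import Relation.Binary.PropositionalEquality using (cong; sym; trans)
  open Sum using (∑<; ∑-*ˡ)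
  open Windows using (stair; stairsAbove; cardS≤)
  open Rational
  open RangeSplit a₁ k₂ k₃ X

  H : ℚᵘ
  H = harmonic a₁ k₂

  private
    Middle : Set
    Middle = ∀ r → r ℕ.< k₂ → X ℕ.≤ stair (suc ((k₂ ∸ r) ℕ.+ k₃)) (a₁ ℕ.+ r)

    ∑middle≤ : Middle →
      ℕ→ℚ (∑[ r < k₂ ] (4 ℕ.* stairsAbove N X (a₁ ℕ.+ r))) + ℕ→ℚ (4 ℕ.* X) * H ≤ ℕ→ℚ (∑< k₂ middleCap)
    ∑middle≤ middle = begin
      ℕ→ℚ (∑< k₂ R) + ℕ→ℚ (4 ℕ.* X) * H
        ≃⟨ +-cong (ℕ→ℚ-∑ k₂ R) (≃-sym (∑ℚ-*ˡ k₂ (ℕ→ℚ (4 ℕ.* X)) (λ r → 1/ ℕ→ℚ (suc (a₁ ℕ.+ r))))) ⟩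
      ∑ℚ[ r < k₂ ] ℕ→ℚ (R r) + ∑ℚ[ r < k₂ ] (ℕ→ℚ (4 ℕ.* X) * 1/ ℕ→ℚ (suc (a₁ ℕ.+ r)))
        ≃⟨ ∑ℚ-distrib-+ k₂ (λ r → ℕ→ℚ (R r)) (λ r → ℕ→ℚ (4 ℕ.* X) * 1/ ℕ→ℚ (suc (a₁ ℕ.+ r))) ⟨
      ∑ℚ[ r < k₂ ] (ℕ→ℚ (R r) + ℕ→ℚ (4 ℕ.* X) * 1/ ℕ→ℚ (suc (a₁ ℕ.+ r)))
        ≤⟨ ∑ℚ-mono-≤ k₂ (λ r r<k₂ → ℕ→ℚ-+-*-1/-≤ (a₁ ℕ.+ r) (R r) (4 ℕ.* X) (middleCap r)
                                       (middle-term r r<k₂ (middle r r<k₂))) ⟩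
      ∑ℚ[ r < k₂ ] ℕ→ℚ (middleCap r)
        ≃⟨ ℕ→ℚ-∑ k₂ middleCap ⟨
      ℕ→ℚ (∑< k₂ middleCap) ∎
      where
      open ≤-Reasoning
      R : ℕ → ℕ
      R r = 4 ℕ.* stairsAbove N X (a₁ ℕ.+ r)

  4cardS+4XH≤ : ∀ {n} a → n ℕ.≤ N → AllPairs ℕ._<_ a → All (λ x → 1 ℕ.≤ x × x ℕ.≤ n) a →
    (∀ ℓ → ℓ ℕ.< a₁ → stair (N ∸ ℓ) ℓ ℕ.≤ X) → Middle →
    ℕ→ℚ (4 ℕ.* cardS a) + ℕ→ℚ (4 ℕ.* X) * H ≤ ℕ→ℚ (4 ℕ.* X ℕ.+ lowerOrder)
  4cardS+4XH≤ a n≤N <a bounds short middle = begin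
    ℕ→ℚ (4 ℕ.* cardS a) + 4XH          ≤⟨ +-monoˡ-≤ 4XH (ℕ→ℚ-mono-≤ 4cardS≤) ⟩
    ℕ→ℚ (Rm ℕ.+ rest) + 4XH            ≃⟨ +-congˡ 4XH (ℕ→ℚ-+ Rm rest) ⟩
    (ℕ→ℚ Rm + ℕ→ℚ rest) + 4XH          ≃⟨ swap (ℕ→ℚ Rm) (ℕ→ℚ rest) 4XH ⟩
    (ℕ→ℚ Rm + 4XH) + ℕ→ℚ rest          ≤⟨ +-monoˡ-≤ (ℕ→ℚ rest) (∑middle≤ middle) ⟩
    ℕ→ℚ (∑< k₂ middleCap) + ℕ→ℚ rest         ≃⟨ ℕ→ℚ-+ (∑< k₂ middleCap) rest ⟨
    ℕ→ℚ (∑< k₂ middleCap ℕ.+ rest)           ≡⟨ cong ℕ→ℚ ∑middleCap+rest≡ ⟩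
    ℕ→ℚ (4 ℕ.* X ℕ.+ lowerOrder)       ∎
    where
    open ≤-Reasoning
    4XH = ℕ→ℚ (4 ℕ.* X) * H
    mid = ∑[ r < k₂ ] stairsAbove N X (a₁ ℕ.+ r)
    tail = ∑[ r < k₃ ] (k₃ ∸ r)
    Rm = ∑[ r < k₂ ] (4 ℕ.* stairsAbove N X (a₁ ℕ.+ r))
    rest = 4 ℕ.* suc X ℕ.+ 4 ℕ.* tail
    swap : ∀ a b c → (a + b) + c ≃ (a + c) + b
    swap = solve-∀ ℚᵘ-ring
    regroup : ∀ x m t → 4 ℕ.* (suc x ℕ.+ (m ℕ.+ t)) ≡ 4 ℕ.* m ℕ.+ (4 ℕ.* suc x ℕ.+ 4 ℕ.* t)
    regroup = solve-∀ ℕ-ring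
    4cardS≤ : 4 ℕ.* cardS a ℕ.≤ Rm ℕ.+ rest
    4cardS≤ = ℕ.≤-trans (ℕ.*-monoʳ-≤ 4 (ℕ.≤-trans (cardS≤ N X a n≤N <a bounds)
                                                  (ℕ.+-monoʳ-≤ (suc X) (∑stairsAbove≤ short))))
                        (ℕ.≤-reflexive (trans (regroup X mid tail)
                                              (cong (ℕ._+ rest) (sym (∑-*ˡ k₂ 4 (λ r → stairsAbove N X (a₁ ℕ.+ r)))))))


module Exponential where

  import Data.Integer.Base as ℤ
  open import Data.Nat.Base as ℕ using (zero; suc; _!; _^_)
  import Data.Nat.Properties as ℕ
  open import Data.Rational.Unnormalised.Base
  open import Data.Rational.Unnormalised.Properties
  open import Data.Product using (_,_)
  open import Relation.Binary.PropositionalEquality using (refl; cong; sym)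
  open import Relation.Nullary using (yes; no)
  open Rational

  expTerm : ℕ → ℚᵘ → ℚᵘ
  expTerm zero    y = 1ℚᵘ
  expTerm (suc j) y = expTerm j y * y * 1/ ℕ→ℚ (suc j)

  expPartial : ℕ → ℚᵘ → ℚᵘ
  expPartial zero    y = 1ℚᵘ
  expPartial (suc K) y = expPartial K y + expTerm (suc K) y

  0≤expTerm : ∀ j {y} → 0ℚᵘ ≤ y → 0ℚᵘ ≤ expTerm j y
  0≤expTerm zero    0≤y = 0≤1
  0≤expTerm (suc j) 0≤y = 0≤* (0≤* (0≤expTerm j 0≤y) 0≤y) (0≤1/ℕ→ℚ-suc j)

  expTerm-cong : ∀ j {y z} → y ≃ z → expTerm j y ≃ expTerm j z
  expTerm-cong zero    y≃z = ≃-refl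
  expTerm-cong (suc j) y≃z = *-cong (*-cong (expTerm-cong j y≃z) y≃z) ≃-refl

  expPartial-cong : ∀ K {y z} → y ≃ z → expPartial K y ≃ expPartial K z
  expPartial-cong zero    y≃z = ≃-refl
  expPartial-cong (suc K) y≃z = +-cong (expPartial-cong K y≃z) (expTerm-cong (suc K) y≃z)

  expTerm-monoʳ-≤ : ∀ j {y z} → 0ℚᵘ ≤ y → y ≤ z → expTerm j y ≤ expTerm j z
  expTerm-monoʳ-≤ zero    0≤y y≤z = ≤-refl
  expTerm-monoʳ-≤ (suc j) 0≤y y≤z = *-monoˡ-≤′ (0≤1/ℕ→ℚ-suc j)
    (*-mono-≤′ (0≤expTerm j 0≤y) 0≤y (expTerm-monoʳ-≤ j 0≤y y≤z) y≤z)

  expPartial-≤-suc : ∀ K {y} → 0ℚᵘ ≤ y → expPartial K y ≤ expPartial (suc K) y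
  expPartial-≤-suc K 0≤y = p≤p+q′ (0≤expTerm (suc K) 0≤y)

  expPartial-monoˡ-≤ : ∀ d K {y} → 0ℚᵘ ≤ y → expPartial K y ≤ expPartial (d ℕ.+ K) y
  expPartial-monoˡ-≤ zero    K 0≤y = ≤-refl
  expPartial-monoˡ-≤ (suc d) K 0≤y = ≤-trans (expPartial-monoˡ-≤ d K 0≤y) (expPartial-≤-suc (d ℕ.+ K) 0≤y)

  -- Uses y · expTerm j y = (j + 1) · expTerm (j + 1) y; the remainder x² · expTerm j y / (j + 2)
  -- is dropped.
  expTerm-suc-+ : ∀ j {x y} → 0ℚᵘ ≤ x → 0ℚᵘ ≤ y →
                  expTerm (suc j) y + x * expTerm j y ≤ expTerm (suc j) (x + y)
  expTerm-suc-+ zero {x} {y} _ _ = ≤-reflexive (identity x y)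
    where
    identity : ∀ x y → 1ℚᵘ * y * 1ℚᵘ + x * 1ℚᵘ ≃ 1ℚᵘ * (x + y) * 1ℚᵘ
    identity = solve-∀ ℚᵘ-ring
  expTerm-suc-+ (suc j) {x} {y} 0≤x 0≤y = begin
    b * y * w + x * b                               ≤⟨ p≤p+q′ remainder≥0 ⟩
    (b * y * w + x * b) + x * x * a * w             ≃⟨ expand ⟨
    (b + x * a) * (x + y) * w                       ≤⟨ *-monoˡ-≤′ (0≤1/ℕ→ℚ-suc (suc j))
                                                         (*-monoˡ-≤′ 0≤x+y (expTerm-suc-+ j 0≤x 0≤y)) ⟩
    expTerm (suc j) (x + y) * (x + y) * w           ∎
    where
    open ≤-Reasoning
    a = expTerm j y
    v = 1/ ℕ→ℚ (suc j)
    w = 1/ ℕ→ℚ (suc (suc j))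
    b = a * y * v
    c = ℕ→ℚ (suc j)
    0≤x+y : 0ℚᵘ ≤ x + y
    0≤x+y = ≤-trans 0≤x (p≤p+q′ 0≤y)
    remainder≥0 : 0ℚᵘ ≤ x * x * a * w
    remainder≥0 = 0≤* (0≤* (0≤* 0≤x 0≤x) (0≤expTerm j 0≤y)) (0≤1/ℕ→ℚ-suc (suc j))
    identity : ∀ a y v w x c → (a * y * v + x * a) * (x + y) * w ≃
                 (a * y * v * y * w + x * (a * y * v)) + x * x * a * w
                 + x * (a * y * v) * ((1ℚᵘ + c) * w - 1ℚᵘ) + x * w * a * y * (1ℚᵘ - c * v)
    identity = solve-∀ ℚᵘ-ring
    [1+c]w≃1 : (1ℚᵘ + c) * w - 1ℚᵘ ≃ 0ℚᵘ
    [1+c]w≃1 = ≃-trans (+-congˡ (- 1ℚᵘ) (≃-trans (*-congʳ {w} (≃-sym (ℕ→ℚ-+ 1 (suc j))))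
                                                  (*-inverseʳ (ℕ→ℚ (suc (suc j))))))
                       (+-inverseʳ 1ℚᵘ)
    cv≃1 : 1ℚᵘ - c * v ≃ 0ℚᵘ
    cv≃1 = ≃-trans (+-congʳ 1ℚᵘ (-‿cong (*-inverseʳ c))) (+-inverseʳ 1ℚᵘ)
    drop-zeros : ∀ P p q {u v} → u ≃ 0ℚᵘ → v ≃ 0ℚᵘ → P + p * u + q * v ≃ P
    drop-zeros P p q u≃0 v≃0 =
      ≃-trans (+-cong (+-congʳ P (≃-trans (*-congˡ {p} u≃0) (*-zeroʳ p))) (≃-trans (*-congˡ {q} v≃0) (*-zeroʳ q)))
              (≃-trans (+-assoc P 0ℚᵘ 0ℚᵘ) (≃-trans (+-congʳ P (+-identityʳ 0ℚᵘ)) (+-identityʳ P)))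
    expand : (b + x * a) * (x + y) * w ≃ (b * y * w + x * b) + x * x * a * w
    expand = ≃-trans (identity a y v w x c) (drop-zeros _ (x * b) (x * w * a * y) [1+c]w≃1 cv≃1)

  expPartial-suc-+ : ∀ K {x y} → 0ℚᵘ ≤ x → 0ℚᵘ ≤ y →
                     expPartial (suc K) y + x * expPartial K y ≤ expPartial (suc K) (x + y)
  expPartial-suc-+ zero {x} {y} 0≤x 0≤y = begin
    (1ℚᵘ + expTerm 1 y) + x * 1ℚᵘ         ≃⟨ +-assoc 1ℚᵘ (expTerm 1 y) (x * 1ℚᵘ) ⟩
    1ℚᵘ + (expTerm 1 y + x * expTerm 0 y) ≤⟨ +-monoʳ-≤ 1ℚᵘ (expTerm-suc-+ 0 0≤x 0≤y) ⟩
    1ℚᵘ + expTerm 1 (x + y)               ∎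
    where open ≤-Reasoning
  expPartial-suc-+ (suc K) {x} {y} 0≤x 0≤y = begin
    (E₁ + t₂) + x * (E₀ + t₁)             ≃⟨ regroup E₁ t₂ x E₀ t₁ ⟩
    (E₁ + x * E₀) + (t₂ + x * t₁)         ≤⟨ +-mono-≤ (expPartial-suc-+ K 0≤x 0≤y) (expTerm-suc-+ (suc K) 0≤x 0≤y) ⟩
    expPartial (suc (suc K)) (x + y)      ∎
    where
    open ≤-Reasoning
    E₀ = expPartial K y
    E₁ = expPartial (suc K) y
    t₁ = expTerm (suc K) y
    t₂ = expTerm (suc (suc K)) y
    regroup : ∀ e₁ t₂ x e₀ t₁ → (e₁ + t₂) + x * (e₀ + t₁) ≃ (e₁ + x * e₀) + (t₂ + x * t₁)
    regroup = solve-∀ ℚᵘ-ring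

  1+x*expPartial≤ : ∀ K {x y} → 0ℚᵘ ≤ x → 0ℚᵘ ≤ y → (1ℚᵘ + x) * expPartial K y ≤ expPartial (suc K) (x + y)
  1+x*expPartial≤ K {x} {y} 0≤x 0≤y = begin
    (1ℚᵘ + x) * expPartial K y                 ≃⟨ expand x (expPartial K y) ⟩
    expPartial K y + x * expPartial K y        ≤⟨ +-monoˡ-≤ (x * expPartial K y) (expPartial-≤-suc K 0≤y) ⟩
    expPartial (suc K) y + x * expPartial K y  ≤⟨ expPartial-suc-+ K 0≤x 0≤y ⟩
    expPartial (suc K) (x + y)                 ∎
    where
    open ≤-Reasoning
    expand : ∀ x e → (1ℚᵘ + x) * e ≃ e + x * e
    expand = solve-∀ ℚᵘ-ring

  expTerm-1 : ∀ y → expTerm 1 y ≃ y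
  expTerm-1 y = identity y
    where
    identity : ∀ y → 1ℚᵘ * y * 1ℚᵘ ≃ y
    identity = solve-∀ ℚᵘ-ring

  expPartial-suc+gap≤ : ∀ K {y} → 0ℚᵘ ≤ y → y ≤ ℕ→ℚ 2 →
                        expPartial (suc K) y + (ℕ→ℚ 2 - y) ≤ expPartial (suc K) (ℕ→ℚ 2)
  expPartial-suc+gap≤ zero {y} 0≤y y≤2 = ≤-reflexive (begin-equality
    (1ℚᵘ + expTerm 1 y) + (ℕ→ℚ 2 - y) ≃⟨ +-congˡ (ℕ→ℚ 2 - y) (+-congʳ 1ℚᵘ (expTerm-1 y)) ⟩
    (1ℚᵘ + y) + (ℕ→ℚ 2 - y)           ≃⟨ cancel y ⟩
    1ℚᵘ + ℕ→ℚ 2                       ≃⟨ +-congʳ 1ℚᵘ (expTerm-1 (ℕ→ℚ 2)) ⟨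
    1ℚᵘ + expTerm 1 (ℕ→ℚ 2)           ∎)
    where
    open ≤-Reasoning
    cancel : ∀ y → (1ℚᵘ + y) + (ℕ→ℚ 2 - y) ≃ 1ℚᵘ + ℕ→ℚ 2
    cancel = solve-∀ ℚᵘ-ring
  expPartial-suc+gap≤ (suc K) {y} 0≤y y≤2 = begin
    (expPartial (suc K) y + expTerm (suc (suc K)) y) + (ℕ→ℚ 2 - y)
      ≃⟨ swap (expPartial (suc K) y) (expTerm (suc (suc K)) y) (ℕ→ℚ 2 - y) ⟩
    (expPartial (suc K) y + (ℕ→ℚ 2 - y)) + expTerm (suc (suc K)) y
      ≤⟨ +-mono-≤ (expPartial-suc+gap≤ K 0≤y y≤2) (expTerm-monoʳ-≤ (suc (suc K)) 0≤y y≤2) ⟩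
    expPartial (suc K) (ℕ→ℚ 2) + expTerm (suc (suc K)) (ℕ→ℚ 2) ∎
    where
    open ≤-Reasoning
    swap : ∀ a b c → (a + b) + c ≃ (a + c) + b
    swap = solve-∀ ℚᵘ-ring

  -- Each factor ((a + 2) / (a + 1))² = (1 + 1/(a + 1))² is bounded by two factors 1 + x ≤ eˣ.
  [1+a+k]²≤[1+a]²*expPartial : ∀ k a →
    ℕ→ℚ (suc a ℕ.+ k) * ℕ→ℚ (suc a ℕ.+ k) ≤
    ℕ→ℚ (suc a) * ℕ→ℚ (suc a) * expPartial (2 ℕ.* k) (ℕ→ℚ 2 * harmonic a k)
  [1+a+k]²≤[1+a]²*expPartial zero    a = ≤-reflexive (begin-equality
    ℕ→ℚ (suc a ℕ.+ 0) * ℕ→ℚ (suc a ℕ.+ 0) ≡⟨ cong (λ b → ℕ→ℚ b * ℕ→ℚ b) (ℕ.+-identityʳ (suc a)) ⟩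
    ℕ→ℚ (suc a) * ℕ→ℚ (suc a)             ≃⟨ *-identityʳ _ ⟨
    ℕ→ℚ (suc a) * ℕ→ℚ (suc a) * 1ℚᵘ       ∎)
    where open ≤-Reasoning
  [1+a+k]²≤[1+a]²*expPartial (suc k) a = begin
    ℕ→ℚ (suc a ℕ.+ suc k) * ℕ→ℚ (suc a ℕ.+ suc k)
      ≡⟨ cong (λ b → ℕ→ℚ b * ℕ→ℚ b) (ℕ.+-suc (suc a) k) ⟩
    ℕ→ℚ (suc (suc a) ℕ.+ k) * ℕ→ℚ (suc (suc a) ℕ.+ k)
      ≤⟨ [1+a+k]²≤[1+a]²*expPartial k (suc a) ⟩
    ℕ→ℚ (suc (suc a)) * ℕ→ℚ (suc (suc a)) * E (2 ℕ.* k) y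
      ≃⟨ *-congʳ {E (2 ℕ.* k) y} (*-cong 2+a≃ 2+a≃) ⟩
    (c * (1ℚᵘ + x)) * (c * (1ℚᵘ + x)) * E (2 ℕ.* k) y
      ≃⟨ regroup c x (E (2 ℕ.* k) y) ⟩
    c * c * ((1ℚᵘ + x) * ((1ℚᵘ + x) * E (2 ℕ.* k) y))
      ≤⟨ *-monoʳ-≤′ 0≤c² (*-monoʳ-≤′ 0≤1+x (1+x*expPartial≤ (2 ℕ.* k) 0≤x 0≤y)) ⟩
    c * c * ((1ℚᵘ + x) * E (suc (2 ℕ.* k)) (x + y))
      ≤⟨ *-monoʳ-≤′ 0≤c² (1+x*expPartial≤ (suc (2 ℕ.* k)) 0≤x (≤-trans 0≤x (p≤p+q′ 0≤y))) ⟩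
    c * c * E (suc (suc (2 ℕ.* k))) (x + (x + y))
      ≃⟨ *-congˡ {c * c} (≃-trans (≃-reflexive (cong (λ K → E K (x + (x + y))) (sym (ℕ.*-suc 2 k))))
                                  (expPartial-cong (2 ℕ.* suc k) x+x+y≃)) ⟩
    c * c * E (2 ℕ.* suc k) (ℕ→ℚ 2 * harmonic a (suc k)) ∎
    where
    open ≤-Reasoning
    E = expPartial
    c = ℕ→ℚ (suc a)
    x = 1/ ℕ→ℚ (suc a)
    y = ℕ→ℚ 2 * harmonic (suc a) k
    0≤x : 0ℚᵘ ≤ x
    0≤x = 0≤1/ℕ→ℚ-suc a
    0≤y : 0ℚᵘ ≤ y
    0≤y = 0≤* (0≤ℕ→ℚ 2) (0≤harmonic (suc a) k)
    0≤1+x : 0ℚᵘ ≤ 1ℚᵘ + x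
    0≤1+x = ≤-trans 0≤1 (p≤p+q′ 0≤x)
    0≤c² : 0ℚᵘ ≤ c * c
    0≤c² = 0≤* (0≤ℕ→ℚ (suc a)) (0≤ℕ→ℚ (suc a))
    2+a≃ : ℕ→ℚ (suc (suc a)) ≃ c * (1ℚᵘ + x)
    2+a≃ = begin-equality
      ℕ→ℚ (1 ℕ.+ suc a)      ≃⟨ ℕ→ℚ-+ 1 (suc a) ⟩
      1ℚᵘ + c                ≃⟨ +-congˡ c (*-inverseʳ c) ⟨
      c * x + c              ≃⟨ distrib c x ⟩
      c * (1ℚᵘ + x)          ∎
      where
      distrib : ∀ c x → c * x + c ≃ c * (1ℚᵘ + x)
      distrib = solve-∀ ℚᵘ-ring
    regroup : ∀ c x e → (c * (1ℚᵘ + x)) * (c * (1ℚᵘ + x)) * e ≃ c * c * ((1ℚᵘ + x) * ((1ℚᵘ + x) * e))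
    regroup = solve-∀ ℚᵘ-ring
    x+x+y≃ : x + (x + y) ≃ ℕ→ℚ 2 * harmonic a (suc k)
    x+x+y≃ = ≃-trans (double x (harmonic (suc a) k)) (*-congˡ {ℕ→ℚ 2} (≃-sym (harmonic-suc a k)))
      where
      double : ∀ x h → x + (x + ℕ→ℚ 2 * h) ≃ ℕ→ℚ 2 * (x + h)
      double = solve-∀ ℚᵘ-ring

  expTerm-2≃e²term : ∀ j → expTerm j (ℕ→ℚ 2) ≃ e²term j
  expTerm-2≃e²term j = *-cancelˡ-≃′ (0<ℕ→ℚ (ℕ.1≤n! j)) (≃-trans (j!*expTerm j) (≃-sym j!*e²term))
    where
    j!*expTerm : ∀ j → ℕ→ℚ (j !) * expTerm j (ℕ→ℚ 2) ≃ ℕ→ℚ (2 ^ j)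
    j!*expTerm zero    = *≡* refl
    j!*expTerm (suc j) = begin-equality
      ℕ→ℚ (suc j ℕ.* j !) * (t * two * 1/ s)   ≃⟨ *-congʳ {t * two * 1/ s} (ℕ→ℚ-* (suc j) (j !)) ⟩
      (s * ℕ→ℚ (j !)) * (t * two * 1/ s)       ≃⟨ regroup s (ℕ→ℚ (j !)) t (1/ s) ⟩
      (s * 1/ s) * (two * (ℕ→ℚ (j !) * t))     ≃⟨ *-cong (*-inverseʳ s) (*-congˡ {two} (j!*expTerm j)) ⟩
      1ℚᵘ * (two * ℕ→ℚ (2 ^ j))                ≃⟨ *-identityˡ _ ⟩
      two * ℕ→ℚ (2 ^ j)                        ≃⟨ ℕ→ℚ-* 2 (2 ^ j) ⟨
      ℕ→ℚ (2 ^ suc j)                          ∎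
      where
      open ≤-Reasoning
      two = ℕ→ℚ 2
      s = ℕ→ℚ (suc j)
      t = expTerm j two
      regroup : ∀ s f t i → (s * f) * (t * ℕ→ℚ 2 * i) ≃ (s * i) * (ℕ→ℚ 2 * (f * t))
      regroup = solve-∀ ℚᵘ-ring
    j!*e²term : ℕ→ℚ (j !) * e²term j ≃ ℕ→ℚ (2 ^ j)
    j!*e²term = ℕ→ℚ-*-/ (2 ^ j) (j !) {{j ℕ.!≢0}}

  expPartial-2≃e²partial : ∀ K → expPartial K (ℕ→ℚ 2) ≃ e²partial K
  expPartial-2≃e²partial zero    = ≃-sym (expTerm-2≃e²term 0)
  expPartial-2≃e²partial (suc K) = +-cong (expPartial-2≃e²partial K) (expTerm-2≃e²term (suc K))

  2*expTerm-2-suc≤ : ∀ j → 3 ℕ.≤ j → ℕ→ℚ 2 * expTerm (suc j) (ℕ→ℚ 2) ≤ expTerm j (ℕ→ℚ 2)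
  2*expTerm-2-suc≤ j 3≤j = begin
    two * (t * two * 1/ ℕ→ℚ (suc j))   ≃⟨ regroup t (1/ ℕ→ℚ (suc j)) ⟩
    t * ((two * two) * 1/ ℕ→ℚ (suc j)) ≤⟨ *-monoʳ-≤′ (0≤expTerm j (0≤ℕ→ℚ 2)) (4/[1+j]≤1 j 3≤j) ⟩
    t * 1ℚᵘ                            ≃⟨ *-identityʳ t ⟩
    t                                  ∎
    where
    open ≤-Reasoning
    two = ℕ→ℚ 2
    t = expTerm j two
    regroup : ∀ t i → ℕ→ℚ 2 * (t * ℕ→ℚ 2 * i) ≃ t * ((ℕ→ℚ 2 * ℕ→ℚ 2) * i)
    regroup = solve-∀ ℚᵘ-ring
    4/[1+j]≤1 : ∀ j → 3 ℕ.≤ j → (two * two) * 1/ ℕ→ℚ (suc j) ≤ 1ℚᵘ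
    4/[1+j]≤1 (suc (suc (suc j))) _                             = *≤* (ℤ.+≤+ (ℕ.s≤s (ℕ.s≤s (ℕ.s≤s (ℕ.s≤s ℕ.z≤n)))))
    4/[1+j]≤1 (suc zero)          (ℕ.s≤s ())
    4/[1+j]≤1 (suc (suc zero))    (ℕ.s≤s (ℕ.s≤s ()))

  -- Beyond j₀ ≥ 2 the terms at 2 at least halve, so the tail is at most twice its first term.
  expPartial-2≤ : ∀ j₀ → 2 ℕ.≤ j₀ → ∀ K →
                  expPartial K (ℕ→ℚ 2) ≤ expPartial j₀ (ℕ→ℚ 2) + ℕ→ℚ 2 * expTerm (suc j₀) (ℕ→ℚ 2)
  expPartial-2≤ j₀ 2≤j₀ K with K ℕ.≤? j₀
  ... | yes K≤j₀ = ≤-trans (≤-trans (expPartial-monoˡ-≤ (j₀ ℕ.∸ K) K (0≤ℕ→ℚ 2))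
                                    (≤-reflexive (≃-reflexive (cong (λ K′ → expPartial K′ (ℕ→ℚ 2)) (ℕ.m∸n+n≡m K≤j₀)))))
                           (p≤p+q′ (0≤* (0≤ℕ→ℚ 2) (0≤expTerm (suc j₀) (0≤ℕ→ℚ 2))))
  ... | no K≰j₀ = ≤-trans (≤-reflexive (≃-reflexive (cong E (sym r+1+j₀≡K))))
                          (≤-trans (p≤p+q′ (0≤expTerm (r ℕ.+ suc j₀) (0≤ℕ→ℚ 2))) (telescope r))
    where
    two = ℕ→ℚ 2
    E : ℕ → ℚᵘ
    E K = expPartial K two
    t : ℕ → ℚᵘ
    t j = expTerm j two
    r = K ℕ.∸ suc j₀
    r+1+j₀≡K : r ℕ.+ suc j₀ ≡ K
    r+1+j₀≡K = ℕ.m∸n+n≡m (ℕ.≰⇒> K≰j₀)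
    double : ∀ e a → (e + a) + a ≃ e + ℕ→ℚ 2 * a
    double = solve-∀ ℚᵘ-ring
    telescope : ∀ r → E (r ℕ.+ suc j₀) + t (r ℕ.+ suc j₀) ≤ E j₀ + two * t (suc j₀)
    telescope zero    = ≤-reflexive (double (E j₀) (t (suc j₀)))
    telescope (suc r) = begin
      (E J + t (suc J)) + t (suc J) ≃⟨ double (E J) (t (suc J)) ⟩
      E J + two * t (suc J)         ≤⟨ +-monoʳ-≤ (E J) (2*expTerm-2-suc≤ J (ℕ.≤-trans (ℕ.s≤s 2≤j₀) (ℕ.m≤n+m (suc j₀) r))) ⟩
      E J + t J                     ≤⟨ telescope r ⟩
      E j₀ + two * t (suc j₀)       ∎
      where
      open ≤-Reasoning
      J = r ℕ.+ suc j₀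

  expPartial-2≤e²upper : ∀ m K → expPartial K (ℕ→ℚ 2) ≤ e²upper m
  expPartial-2≤e²upper m K = ≤-trans (expPartial-2≤ (suc (suc m)) (ℕ.s≤s (ℕ.s≤s ℕ.z≤n)) K)
    (≤-reflexive (+-cong (expPartial-2≃e²partial (suc (suc m))) (*-congˡ {ℕ→ℚ 2} (expTerm-2≃e²term (suc (suc (suc m)))))))

  5≤e²upper : ∀ m → ℕ→ℚ 5 ≤ e²upper m
  5≤e²upper m = ≤-trans (≤-reflexive (*≡* refl)) (expPartial-2≤e²upper m 2)

  c₄<½ : c₄< ½
  c₄<½ = 0 , <-respʳ-≃ (≃-sym (≃-trans (*-congʳ {U + 1ℚᵘ} 2*½≃1) (*-identityˡ (U + 1ℚᵘ))))
                       (+-monoʳ-< U -1<1)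
    where
    U = e²upper 0
    -1<1 : - 1ℚᵘ < 1ℚᵘ
    -1<1 = *<* (ℤ.-<+ {0} {1})
    2*½≃1 : ℕ→ℚ 2 * ½ ≃ 1ℚᵘ
    2*½≃1 = *≡* refl

  -- ((a + 1 + k) / (a + 1))² ≤ e^{2H} ≤ e² - 2 + 2H by [1+a+k]²≤[1+a]²*expPartial and
  -- expPartial-suc+gap≤ (trivial if H > 1).
  1-harmonic≤ : ∀ m a k {δ} → 0ℚᵘ ≤ δ →
    (e²upper m - ℕ→ℚ 2 * δ) * ℕ→ℚ (suc a ℕ.* suc a) ≤ ℕ→ℚ ((suc a ℕ.+ k) ℕ.* (suc a ℕ.+ k)) →
    1ℚᵘ - harmonic a k ≤ δ
  1-harmonic≤ m a k {δ} 0≤δ hyp with harmonic a k ≤? 1ℚᵘ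
  ... | no  H≰1 = ≤-trans (p≤q⇒p-q≤0 (<⇒≤ (≰⇒> H≰1))) 0≤δ
  ... | yes H≤1 = *-cancelˡ-≤′ {ℕ→ℚ 2} (0<ℕ→ℚ (ℕ.s≤s ℕ.z≤n))
                    (p-q≤0⇒p≤q (≤-trans (≤-reflexive (identity U H δ)) (p≤q⇒p-q≤0 U-2δ≤U-2+2H)))
    where
    U = e²upper m
    H = harmonic a k
    y = ℕ→ℚ 2 * H
    c² = ℕ→ℚ (suc a) * ℕ→ℚ (suc a)
    0≤y : 0ℚᵘ ≤ y
    0≤y = 0≤* (0≤ℕ→ℚ 2) (0≤harmonic a k)
    y≤2 : y ≤ ℕ→ℚ 2
    y≤2 = ≤-trans (*-monoʳ-≤′ (0≤ℕ→ℚ 2) H≤1) (≤-reflexive (*-identityʳ (ℕ→ℚ 2)))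
    shift : ∀ u y → u - (ℕ→ℚ 2 - y) ≃ u - ℕ→ℚ 2 + y
    shift = solve-∀ ℚᵘ-ring
    expPartial≤ : expPartial (2 ℕ.* k) y ≤ U - ℕ→ℚ 2 + y
    expPartial≤ = begin
      expPartial (2 ℕ.* k) y        ≤⟨ expPartial-≤-suc (2 ℕ.* k) 0≤y ⟩
      expPartial (suc (2 ℕ.* k)) y  ≤⟨ p+q≤r⇒p≤r-q (≤-trans (expPartial-suc+gap≤ (2 ℕ.* k) 0≤y y≤2)
                                                             (expPartial-2≤e²upper m (suc (2 ℕ.* k)))) ⟩
      U - (ℕ→ℚ 2 - y)               ≃⟨ shift U y ⟩
      U - ℕ→ℚ 2 + y                 ∎
      where open ≤-Reasoning
    U-2δ≤U-2+2H : U - ℕ→ℚ 2 * δ ≤ U - ℕ→ℚ 2 + y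
    U-2δ≤U-2+2H = *-cancelˡ-≤′ {c²} (0<* (0<ℕ→ℚ {suc a} (ℕ.s≤s ℕ.z≤n)) (0<ℕ→ℚ {suc a} (ℕ.s≤s ℕ.z≤n))) (begin
      c² * (U - ℕ→ℚ 2 * δ)  ≃⟨ *-comm c² (U - ℕ→ℚ 2 * δ) ⟩
      (U - ℕ→ℚ 2 * δ) * c²  ≃⟨ *-congˡ {U - ℕ→ℚ 2 * δ} (ℕ→ℚ-* (suc a) (suc a)) ⟨
      (U - ℕ→ℚ 2 * δ) * ℕ→ℚ (suc a ℕ.* suc a) ≤⟨ hyp ⟩
      ℕ→ℚ ((suc a ℕ.+ k) ℕ.* (suc a ℕ.+ k)) ≃⟨ ℕ→ℚ-* (suc a ℕ.+ k) (suc a ℕ.+ k) ⟩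
      ℕ→ℚ (suc a ℕ.+ k) * ℕ→ℚ (suc a ℕ.+ k) ≤⟨ [1+a+k]²≤[1+a]²*expPartial k a ⟩
      c² * expPartial (2 ℕ.* k) y ≤⟨ *-monoʳ-≤′ (0≤* (0≤ℕ→ℚ (suc a)) (0≤ℕ→ℚ (suc a))) expPartial≤ ⟩
      c² * (U - ℕ→ℚ 2 + y) ∎)
      where open ≤-Reasoning
    identity : ∀ U H δ → ℕ→ℚ 2 * (1ℚᵘ - H) - ℕ→ℚ 2 * δ ≃ (U - ℕ→ℚ 2 * δ) - (U - ℕ→ℚ 2 + ℕ→ℚ 2 * H)
    identity = solve-∀ ℚᵘ-ring


module Shape (A u : ℕ) where

  open import Data.Nat.Base

  B D V P₁ : ℕ
  B  = A + u
  D  = A * A + B * B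
  V  = 2 * A * u + u * u
  P₁ = 14 * A * u + 6 * (u * u)


-- Windows of length at most 2A²t in [1, Dt] have sums at most X = 2A²B²t², and the harmonic
-- sum runs over the lengths 2A²t ≤ L < 2ABt, so it is about log (B / A). The parameter
-- w = B² - 2A² comes with its defining equation to avoid truncated subtraction.
module Parameters (A u t w : ℕ) (A≥1 : 1 ℕ.≤ A) (t≥1 : 1 ℕ.≤ t)
                  (A²+w≡2Au+u² : A ℕ.* A ℕ.+ w ≡ 2 ℕ.* A ℕ.* u ℕ.+ u ℕ.* u) where

  open import Data.Nat.Base
  open import Data.Nat.Properties
  open import Relation.Binary.PropositionalEquality
  open Windows using (stair; stair-closed)

  open Shape A u public

  L₁ a₁ k₂ k₃ X v : ℕ
  L₁ = 2 * A * A * t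
  a₁ = pred L₁
  k₂ = 2 * A * u * t
  k₃ = suc (u * u * t)
  X  = 2 * (A * (B * B) * t) * (A * t)
  v  = 2 * w * t

  open RangeSplit a₁ k₂ k₃ X public using (N; lowerOrder)

  1+a₁≡L₁ : suc a₁ ≡ L₁
  1+a₁≡L₁ = suc-pred L₁ {{>-nonZero (*-mono-≤ (*-mono-≤ (*-mono-≤ {1} {2} (s≤s z≤n) A≥1) A≥1) t≥1)}}

  N≡1+a₁+k₂+u²t : N ≡ suc a₁ + (k₂ + u * u * t)
  N≡1+a₁+k₂+u²t = trans (cong (a₁ +_) (+-suc k₂ (u * u * t))) (+-suc a₁ _)

  N≡D*t : N ≡ D * t
  N≡D*t = trans N≡1+a₁+k₂+u²t (trans (cong (_+ (k₂ + u * u * t)) 1+a₁≡L₁) (expand A u t))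
    where
    expand : ∀ A u t → 2 * A * A * t + (2 * A * u * t + u * u * t) ≡ (A * A + (A + u) * (A + u)) * t
    expand = solve-∀ ℕ-ring

  B²≡2A²+w : B * B ≡ A * A + (A * A + w)
  B²≡2A²+w = trans (expand A u) (cong (A * A +_) (sym A²+w≡2Au+u²))
    where
    expand : ∀ A u → (A + u) * (A + u) ≡ A * A + (2 * A * u + u * u)
    expand = solve-∀ ℕ-ring

  2N≡3L₁+v : 2 * N ≡ 3 * L₁ + v
  2N≡3L₁+v = trans (cong (λ n → 2 * n) N≡D*t) (trans (cong (λ b → 2 * ((A * A + b) * t)) B²≡2A²+w) (expand A w t))
    where
    expand : ∀ A w t → 2 * ((A * A + (A * A + (A * A + w))) * t) ≡ 3 * (2 * A * A * t) + 2 * w * t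
    expand = solve-∀ ℕ-ring

  2X≡L₁[2L₁+v] : 2 * X ≡ L₁ * (2 * L₁ + v)
  2X≡L₁[2L₁+v] = trans (cong (λ b → 2 * (2 * (A * b * t) * (A * t))) B²≡2A²+w) (expand A w t)
    where
    expand : ∀ A w t → 2 * (2 * (A * (A * A + (A * A + w)) * t) * (A * t)) ≡ (2 * A * A * t) * (2 * (2 * A * A * t) + 2 * w * t)
    expand = solve-∀ ℕ-ring

  2X+L₁²≡2L₁N : 2 * X + L₁ * L₁ ≡ 2 * L₁ * N
  2X+L₁²≡2L₁N = trans (expand A u t) (cong (2 * L₁ *_) (sym N≡D*t))
    where
    expand : ∀ A u t → 2 * (2 * (A * ((A + u) * (A + u)) * t) * (A * t)) + (2 * A * A * t) * (2 * A * A * t)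
                       ≡ 2 * (2 * A * A * t) * ((A * A + (A + u) * (A + u)) * t)
    expand = solve-∀ ℕ-ring

  1+a₁+k₂≡2ABt : suc a₁ + k₂ ≡ 2 * A * B * t
  1+a₁+k₂≡2ABt = trans (cong (_+ k₂) 1+a₁≡L₁) (factor A u t)
    where
    factor : ∀ A u t → 2 * A * A * t + 2 * A * u * t ≡ 2 * A * (A + u) * t
    factor = solve-∀ ℕ-ring

  lowerOrder≡ : lowerOrder ≡ 2 * D * V * (t * t) + P₁ * t + 8
  lowerOrder≡ = trans (cong (λ c → 4 + (3 * (k₂ * k₂) + k₂ + 2 * k₂ * c) + 2 * (k₃ * suc k₃)) 2k₃+a₁+2≡)
                      (expand A u t)
    where
    2k₃+a₁+2≡ : 2 * k₃ + a₁ + 2 ≡ 2 * k₃ + suc L₁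
    2k₃+a₁+2≡ = trans (shift (2 * k₃) a₁) (cong (λ l → 2 * k₃ + suc l) 1+a₁≡L₁)
      where
      shift : ∀ k a → k + a + 2 ≡ k + suc (suc a)
      shift = solve-∀ ℕ-ring
    expand : ∀ A u t → 4 + (3 * ((2 * A * u * t) * (2 * A * u * t)) + 2 * A * u * t
                            + 2 * (2 * A * u * t) * (2 * suc (u * u * t) + suc (2 * A * A * t)))
                       + 2 * (suc (u * u * t) * suc (suc (u * u * t)))
                     ≡ 2 * (A * A + (A + u) * (A + u)) * (2 * A * u + u * u) * (t * t) + (14 * A * u + 6 * (u * u)) * t + 8
    expand = solve-∀ ℕ-ring

  short : ∀ ℓ → ℓ < a₁ → stair (N ∸ ℓ) ℓ ≤ X
  short ℓ ℓ<a₁ = *-cancelˡ-≤ 2 (begin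
    2 * stair M ℓ                                   ≡⟨ stair-closed M ℓ ⟩
    suc ℓ * (2 * M + ℓ)                             ≡⟨ cong (λ m → suc ℓ * (m + ℓ)) 2M≡ ⟩
    suc ℓ * (ℓ + 6 + 3 * d + v + ℓ)                 ≤⟨ m≤m+n _ _ ⟩
    suc ℓ * (ℓ + 6 + 3 * d + v + ℓ) + slack ℓ d v   ≡⟨ expand ℓ d v ⟩
    (ℓ + 2 + d) * (2 * (ℓ + 2 + d) + v)             ≡⟨ cong (λ l → l * (2 * l + v)) L₁≡ ⟨
    L₁ * (2 * L₁ + v)                               ≡⟨ 2X≡L₁[2L₁+v] ⟨
    2 * X                                           ∎)
    where
    open ≤-Reasoning
    M = N ∸ ℓ
    d = a₁ ∸ suc ℓ
    slack : ℕ → ℕ → ℕ → ℕ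
    slack ℓ d v = d * ℓ + 2 + 5 * d + v + 2 * (d * d) + d * v
    expand : ∀ ℓ d v → suc ℓ * (ℓ + 6 + 3 * d + v + ℓ) + (d * ℓ + 2 + 5 * d + v + 2 * (d * d) + d * v)
                       ≡ (ℓ + 2 + d) * (2 * (ℓ + 2 + d) + v)
    expand = solve-∀ ℕ-ring
    L₁≡ : L₁ ≡ ℓ + 2 + d
    L₁≡ = trans (sym 1+a₁≡L₁) (trans (cong suc (sym (m+[n∸m]≡n ℓ<a₁))) (shift ℓ d))
      where
      shift : ∀ ℓ d → suc (suc ℓ + d) ≡ ℓ + 2 + d
      shift = solve-∀ ℕ-ring
    ℓ+M≡N : ℓ + M ≡ N
    ℓ+M≡N = m+[n∸m]≡n (≤-trans (<⇒≤ ℓ<a₁) (m≤m+n a₁ _))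
    2M≡ : 2 * M ≡ ℓ + 6 + 3 * d + v
    2M≡ = +-cancelˡ-≡ (2 * ℓ) _ _ (begin-equality
      2 * ℓ + 2 * M                ≡⟨ *-distribˡ-+ 2 ℓ M ⟨
      2 * (ℓ + M)                  ≡⟨ cong (2 *_) ℓ+M≡N ⟩
      2 * N                        ≡⟨ 2N≡3L₁+v ⟩
      3 * L₁ + v                   ≡⟨ cong (λ l → 3 * l + v) L₁≡ ⟩
      3 * (ℓ + 2 + d) + v          ≡⟨ expand′ ℓ d v ⟩
      2 * ℓ + (ℓ + 6 + 3 * d + v)  ∎)
      where
      expand′ : ∀ ℓ d v → 3 * (ℓ + 2 + d) + v ≡ 2 * ℓ + (ℓ + 6 + 3 * d + v)
      expand′ = solve-∀ ℕ-ring

  middle : ∀ r → r < k₂ → X ≤ stair (suc ((k₂ ∸ r) + k₃)) (a₁ + r)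
  middle r r<k₂ = *-cancelˡ-≤ 2 (+-cancelʳ-≤ (suc a₁ * suc a₁) _ _ (begin
    2 * X + suc a₁ * suc a₁                              ≡⟨ 2X+[1+a₁]²≡ ⟩
    2 * suc a₁ * N                                       ≡⟨ cong (2 * suc a₁ *_) N≡ ⟩
    2 * suc a₁ * (suc a₁ + r + s)                        ≤⟨ m≤m+n _ _ ⟩
    2 * suc a₁ * (suc a₁ + r + s) + slack a₁ r s         ≡⟨ expand a₁ r s ⟨
    suc (a₁ + r) * (2 * suc (suc s) + (a₁ + r)) + suc a₁ * suc a₁
      ≡⟨ cong (λ c → suc (a₁ + r) * (2 * c + (a₁ + r)) + suc a₁ * suc a₁) (cong suc (+-suc (k₂ ∸ r) (u * u * t))) ⟨
    suc (a₁ + r) * (2 * c + (a₁ + r)) + suc a₁ * suc a₁  ≡⟨ cong (_+ suc a₁ * suc a₁) (stair-closed c (a₁ + r)) ⟨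
    2 * stair c (a₁ + r) + suc a₁ * suc a₁               ∎))
    where
    open ≤-Reasoning
    s = (k₂ ∸ r) + u * u * t
    c = suc ((k₂ ∸ r) + k₃)
    slack : ℕ → ℕ → ℕ → ℕ
    slack a r s = 3 * suc a + 2 * r * s + 3 * r + r * r
    expand : ∀ a r s → suc (a + r) * (2 * suc (suc s) + (a + r)) + suc a * suc a
                       ≡ 2 * suc a * (suc a + r + s) + (3 * suc a + 2 * r * s + 3 * r + r * r)
    expand = solve-∀ ℕ-ring
    2X+[1+a₁]²≡ : 2 * X + suc a₁ * suc a₁ ≡ 2 * suc a₁ * N
    2X+[1+a₁]²≡ = subst (λ l → 2 * X + l * l ≡ 2 * l * N) (sym 1+a₁≡L₁) 2X+L₁²≡2L₁N
    N≡ : N ≡ suc a₁ + r + s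
    N≡ = trans N≡1+a₁+k₂+u²t (trans (cong (λ k → suc a₁ + (k + u * u * t)) (sym (m+[n∸m]≡n (<⇒≤ r<k₂))))
                                    (regroup (suc a₁) r (k₂ ∸ r) (u * u * t)))
      where
      regroup : ∀ a b c d → a + ((b + c) + d) ≡ a + b + (c + d)
      regroup = solve-∀ ℕ-ring

  4X≤2D²t² : 4 * X ≤ 2 * (D * D) * (t * t)
  4X≤2D²t² = begin
    4 * X                                     ≡⟨ expand A B t ⟩
    2 * (4 * (A * A) * (B * B)) * (t * t)     ≤⟨ *-monoˡ-≤ (t * t) (*-monoʳ-≤ 2 (m≤m+n (4 * (A * A) * (B * B)) (V * V))) ⟩
    2 * (4 * (A * A) * (B * B) + V * V) * (t * t) ≡⟨ cong (λ e → 2 * e * (t * t)) (square A u) ⟨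
    2 * (D * D) * (t * t)                     ∎
    where
    open ≤-Reasoning
    expand : ∀ A B t → 4 * (2 * (A * (B * B) * t) * (A * t)) ≡ 2 * (4 * (A * A) * (B * B)) * (t * t)
    expand = solve-∀ ℕ-ring
    square : ∀ A u → (A * A + (A + u) * (A + u)) * (A * A + (A + u) * (A + u))
                     ≡ 4 * (A * A) * ((A + u) * (A + u)) + (2 * A * u + u * u) * (2 * A * u + u * u)
    square = solve-∀ ℕ-ring


module MainBound (A u t w : ℕ) (A≥1 : 1 ℕ.≤ A) (t≥1 : 1 ℕ.≤ t)
                 (A²+w≡2Au+u² : A ℕ.* A ℕ.+ w ≡ 2 ℕ.* A ℕ.* u ℕ.+ u ℕ.* u) where

  open import Data.List.Base using (List)
  open import Data.List.Relation.Unary.All using (All)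
  open import Data.List.Relation.Unary.AllPairs using (AllPairs)
  open import Data.Nat.Base as ℕ using (suc)
  import Data.Nat.Properties as ℕ
  open import Data.Product using (_×_)
  open import Data.Rational.Unnormalised.Base
  open import Data.Rational.Unnormalised.Properties
  open import Relation.Binary.PropositionalEquality using (cong; sym)
  open Rational
  open Exponential using (1-harmonic≤)
  open Parameters A u t w A≥1 t≥1 A²+w≡2Au+u²
  open Estimate a₁ k₂ k₃ X using (H; 4cardS+4XH≤)

  1-H≤δ : ∀ m {δ} → 0ℚᵘ ≤ δ → (e²upper m - ℕ→ℚ 2 * δ) * ℕ→ℚ (A ℕ.* A) ≤ ℕ→ℚ (B ℕ.* B) → 1ℚᵘ - H ≤ δ
  1-H≤δ m {δ} 0≤δ hyp = 1-harmonic≤ m a₁ k₂ 0≤δ (begin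
    (U - ℕ→ℚ 2 * δ) * ℕ→ℚ (suc a₁ ℕ.* suc a₁)      ≡⟨ cong (λ l → (U - ℕ→ℚ 2 * δ) * ℕ→ℚ (l ℕ.* l)) 1+a₁≡L₁ ⟩
    (U - ℕ→ℚ 2 * δ) * ℕ→ℚ (L₁ ℕ.* L₁)              ≡⟨ cong (λ n → (U - ℕ→ℚ 2 * δ) * ℕ→ℚ n) (scale A A t) ⟩
    (U - ℕ→ℚ 2 * δ) * ℕ→ℚ (c ℕ.* (A ℕ.* A))        ≃⟨ *-congˡ {U - ℕ→ℚ 2 * δ} (ℕ→ℚ-* c (A ℕ.* A)) ⟩
    (U - ℕ→ℚ 2 * δ) * (ℕ→ℚ c * ℕ→ℚ (A ℕ.* A))      ≃⟨ swap (U - ℕ→ℚ 2 * δ) (ℕ→ℚ c) (ℕ→ℚ (A ℕ.* A)) ⟩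
    ℕ→ℚ c * ((U - ℕ→ℚ 2 * δ) * ℕ→ℚ (A ℕ.* A))      ≤⟨ *-monoʳ-≤′ (0≤ℕ→ℚ c) hyp ⟩
    ℕ→ℚ c * ℕ→ℚ (B ℕ.* B)                          ≃⟨ ℕ→ℚ-* c (B ℕ.* B) ⟨
    ℕ→ℚ (c ℕ.* (B ℕ.* B))                          ≡⟨ cong ℕ→ℚ (scale A B t) ⟨
    ℕ→ℚ ((2 ℕ.* A ℕ.* B ℕ.* t) ℕ.* (2 ℕ.* A ℕ.* B ℕ.* t))
                                                   ≡⟨ cong (λ l → ℕ→ℚ (l ℕ.* l)) 1+a₁+k₂≡2ABt ⟨
    ℕ→ℚ ((suc a₁ ℕ.+ k₂) ℕ.* (suc a₁ ℕ.+ k₂))      ∎)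
    where
    open ≤-Reasoning
    U = e²upper m
    c = (2 ℕ.* A ℕ.* t) ℕ.* (2 ℕ.* A ℕ.* t)
    scale : ∀ A E t → (2 ℕ.* A ℕ.* E ℕ.* t) ℕ.* (2 ℕ.* A ℕ.* E ℕ.* t) ≡ ((2 ℕ.* A ℕ.* t) ℕ.* (2 ℕ.* A ℕ.* t)) ℕ.* (E ℕ.* E)
    scale = solve-∀ ℕ-ring
    swap : ∀ x y z → x * (y * z) ≃ y * (x * z)
    swap = solve-∀ ℚᵘ-ring

  4cardS≤ : ∀ m {δ} {n} a → n ℕ.≤ D ℕ.* t → AllPairs ℕ._<_ a → All (λ x → 1 ℕ.≤ x × x ℕ.≤ n) a →
    0ℚᵘ ≤ δ → (e²upper m - ℕ→ℚ 2 * δ) * ℕ→ℚ (A ℕ.* A) ≤ ℕ→ℚ (B ℕ.* B) →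
    ℕ→ℚ (4 ℕ.* cardS a) ≤ ℕ→ℚ (2 ℕ.* (D ℕ.* D) ℕ.* (t ℕ.* t)) * δ + ℕ→ℚ (2 ℕ.* D ℕ.* V ℕ.* (t ℕ.* t) ℕ.+ P₁ ℕ.* t ℕ.+ 8)
  4cardS≤ m {δ} a n≤Dt <a bounds 0≤δ hyp = begin
    ℕ→ℚ (4 ℕ.* cardS a)                   ≤⟨ p+q≤r⇒p≤r-q {q = x * H} (4cardS+4XH≤ a (ℕ.≤-trans n≤Dt (ℕ.≤-reflexive (sym N≡D*t)))
                                                                   <a bounds short middle) ⟩
    ℕ→ℚ (4 ℕ.* X ℕ.+ lowerOrder) - x * H  ≃⟨ +-congˡ (- (x * H)) (ℕ→ℚ-+ (4 ℕ.* X) lowerOrder) ⟩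
    (x + ℕ→ℚ lowerOrder) - x * H          ≃⟨ factor x (ℕ→ℚ lowerOrder) H ⟩
    x * (1ℚᵘ - H) + ℕ→ℚ lowerOrder        ≤⟨ +-monoˡ-≤ (ℕ→ℚ lowerOrder) (*-monoʳ-≤′ (0≤ℕ→ℚ (4 ℕ.* X)) (1-H≤δ m 0≤δ hyp)) ⟩
    x * δ + ℕ→ℚ lowerOrder                ≤⟨ +-monoˡ-≤ (ℕ→ℚ lowerOrder) (*-monoˡ-≤′ 0≤δ (ℕ→ℚ-mono-≤ 4X≤2D²t²)) ⟩
    ℕ→ℚ (2 ℕ.* (D ℕ.* D) ℕ.* (t ℕ.* t)) * δ + ℕ→ℚ lowerOrder
                                          ≡⟨ cong (λ l → ℕ→ℚ (2 ℕ.* (D ℕ.* D) ℕ.* (t ℕ.* t)) * δ + ℕ→ℚ l) lowerOrder≡ ⟩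
    ℕ→ℚ (2 ℕ.* (D ℕ.* D) ℕ.* (t ℕ.* t)) * δ + ℕ→ℚ (2 ℕ.* D ℕ.* V ℕ.* (t ℕ.* t) ℕ.+ P₁ ℕ.* t ℕ.+ 8) ∎
    where
    open ≤-Reasoning
    x = ℕ→ℚ (4 ℕ.* X)
    factor : ∀ x l h → (x + l) - x * h ≃ x * (1ℚᵘ - h) + l
    factor = solve-∀ ℚᵘ-ring


module ParameterChoice (q : ℚᵘ) (q≤½ : q Q.≤ Q.½) (c₄<q : c₄< q) where

  import Data.Integer.Base as ℤ
  open import Data.Nat.Base as ℕ using (suc; _∸_)
  import Data.Nat.Properties as ℕ
  open import Data.Rational.Unnormalised.Base
  open import Data.Rational.Unnormalised.Properties
  open import Data.List.Base using (List)
  open import Data.List.Relation.Unary.All using (All)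
  open import Data.List.Relation.Unary.AllPairs using (AllPairs)
  open import Data.Nat.DivMod using (m≡m%n+[m/n]*n; m%n<n; m/n*n≤m) renaming (_/_ to _div_)
  open import Data.Product using (proj₁; proj₂)
  open import Data.Sum using (inj₁; inj₂)
  open import Relation.Binary.PropositionalEquality using (refl; cong; cong₂; sym; trans; subst)
  open import Relation.Nullary.Negation using (contradiction)
  open Rational
  open Exponential using (5≤e²upper)

  m : ℕ
  m = proj₁ c₄<q

  U γ : ℚᵘ
  U = e²upper m
  γ = (ℕ→ℚ 2 * q) * (U + 1ℚᵘ) - (U - 1ℚᵘ)

  0<γ : 0ℚᵘ < γ
  0<γ = <-respˡ-≃ (+-inverseʳ (U - 1ℚᵘ)) (+-monoˡ-< (- (U - 1ℚᵘ)) (proj₂ c₄<q))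

  0≤U : 0ℚᵘ ≤ U
  0≤U = ≤-trans (0≤ℕ→ℚ 5) (5≤e²upper m)

  0≤q : 0ℚᵘ ≤ q
  0≤q with ≤-total q 0ℚᵘ
  ... | inj₂ 0≤q = 0≤q
  ... | inj₁ q≤0 = contradiction (<-≤-trans (<-trans 0<U-1 (proj₂ c₄<q)) 2q[U+1]≤0) (<-irrefl ≃-refl)
    where
    0<U-1 : 0ℚᵘ < U - 1ℚᵘ
    0<U-1 = <-respˡ-≃ (+-inverseʳ 1ℚᵘ) (+-monoˡ-< (- 1ℚᵘ) (<-≤-trans (ℕ→ℚ-mono-< (ℕ.s≤s (ℕ.s≤s ℕ.z≤n))) (5≤e²upper m)))
    2q[U+1]≤0 : (ℕ→ℚ 2 * q) * (U + 1ℚᵘ) ≤ 0ℚᵘ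
    2q[U+1]≤0 = ≤-trans (*-monoˡ-≤′ (≤-trans 0≤U (p≤p+q′ 0≤1))
                          (≤-trans (*-monoʳ-≤′ (0≤ℕ→ℚ 2) q≤0) (≤-reflexive (*-zeroʳ (ℕ→ℚ 2)))))
                        (≤-reflexive (*-zeroˡ (U + 1ℚᵘ)))

  2q≤1 : ℕ→ℚ 2 * q ≤ 1ℚᵘ
  2q≤1 = ≤-trans (*-monoʳ-≤′ (0≤ℕ→ℚ 2) q≤½) (≤-reflexive (*≡* refl))

  γ≤2 : γ ≤ ℕ→ℚ 2
  γ≤2 = ≤-trans (+-monoˡ-≤ (- (U - 1ℚᵘ)) (*-monoˡ-≤′ (≤-trans 0≤U (p≤p+q′ 0≤1)) 2q≤1)) (≤-reflexive (simplify U))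
    where
    simplify : ∀ U → 1ℚᵘ * (U + 1ℚᵘ) - (U - 1ℚᵘ) ≃ ℕ→ℚ 2
    simplify = solve-∀ ℚᵘ-ring

  K : ℕ
  K = ℤ.∣ ↥ U ∣

  U≤K : U ≤ ℕ→ℚ K
  U≤K = p≤ℕ→ℚ∣↥p∣ U

  δ : ℚᵘ
  δ = γ * 1/ ℕ→ℚ (4 ℕ.* suc K)

  δ*4[1+K]≃γ : δ * ℕ→ℚ (4 ℕ.* suc K) ≃ γ
  δ*4[1+K]≃γ = ≃-trans (*-assoc γ _ _) (≃-trans (*-congˡ {γ} (*-inverseˡ (ℕ→ℚ (4 ℕ.* suc K)))) (*-identityʳ γ))

  0≤δ : 0ℚᵘ ≤ δ
  0≤δ = 0≤* (<⇒≤ 0<γ) (*≤* (ℤ.+≤+ ℕ.z≤n))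

  δ≤1 : δ ≤ 1ℚᵘ
  δ≤1 = *-cancelˡ-≤′ {ℕ→ℚ (4 ℕ.* suc K)} (0<ℕ→ℚ (ℕ.s≤s ℕ.z≤n)) (begin
    ℕ→ℚ (4 ℕ.* suc K) * δ     ≃⟨ *-comm (ℕ→ℚ (4 ℕ.* suc K)) δ ⟩
    δ * ℕ→ℚ (4 ℕ.* suc K)     ≃⟨ δ*4[1+K]≃γ ⟩
    γ                         ≤⟨ γ≤2 ⟩
    ℕ→ℚ 2                     ≤⟨ ℕ→ℚ-mono-≤ (ℕ.≤-trans (ℕ.s≤s (ℕ.s≤s ℕ.z≤n)) (ℕ.m≤m*n 4 (suc K))) ⟩
    ℕ→ℚ (4 ℕ.* suc K)         ≃⟨ *-identityʳ _ ⟨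
    ℕ→ℚ (4 ℕ.* suc K) * 1ℚᵘ   ∎)
    where open ≤-Reasoning

  G : ℕ
  G = suc (proj₁ (archimedean γ 0<γ))

  1≤γG : 1ℚᵘ ≤ γ * ℕ→ℚ G
  1≤γG = proj₂ (archimedean γ 0<γ)

  -- The factor 2K + 1 makes 2δA² ≥ 2KA + 1 ≥ 2B + 1 = (B + 1)² - B², so rounding A √U down
  -- to the integer B below costs at most 2δA².
  A : ℕ
  A = (2 ℕ.* K ℕ.+ 1) ℕ.* (4 ℕ.* suc K ℕ.* G)

  1≤A : 1 ℕ.≤ A
  1≤A = ℕ.*-mono-≤ {1} {2 ℕ.* K ℕ.+ 1} {1} (ℕ.m≤n+m 1 (2 ℕ.* K)) (ℕ.*-mono-≤ {1} {4 ℕ.* suc K} {1} (ℕ.s≤s ℕ.z≤n) (ℕ.s≤s ℕ.z≤n))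

  private
    FitsUnder : ℕ → Set
    FitsUnder b = ℕ→ℚ (b ℕ.* b) ≤ U * ℕ→ℚ (A ℕ.* A)

    ¬FitsUnder[1+KA] : ¬ FitsUnder (suc (K ℕ.* A))
    ¬FitsUnder[1+KA] fits = <-irrefl ≃-refl (≤-<-trans fits (begin-strict
      U * ℕ→ℚ (A ℕ.* A)                  ≤⟨ *-monoˡ-≤′ (0≤ℕ→ℚ (A ℕ.* A)) U≤K ⟩
      ℕ→ℚ K * ℕ→ℚ (A ℕ.* A)              ≃⟨ ℕ→ℚ-* K (A ℕ.* A) ⟨
      ℕ→ℚ (K ℕ.* (A ℕ.* A))              ≤⟨ ℕ→ℚ-mono-≤ (ℕ.≤-trans (ℕ.m≤m*n (K ℕ.* (A ℕ.* A)) K {{ℕ.>-nonZero 1≤K}}) (ℕ.≤-reflexive (regroup K A))) ⟩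
      ℕ→ℚ ((K ℕ.* A) ℕ.* (K ℕ.* A))      <⟨ ℕ→ℚ-mono-< (ℕ.*-mono-< (ℕ.n<1+n (K ℕ.* A)) (ℕ.n<1+n (K ℕ.* A))) ⟩
      ℕ→ℚ (suc (K ℕ.* A) ℕ.* suc (K ℕ.* A)) ∎))
      where
      open ≤-Reasoning
      1≤K : 1 ℕ.≤ K
      1≤K = ℕ→ℚ-cancel-≤ (≤-trans (ℕ→ℚ-mono-≤ (ℕ.s≤s ℕ.z≤n)) (≤-trans (5≤e²upper m) U≤K))
      regroup : ∀ K A → K ℕ.* (A ℕ.* A) ℕ.* K ≡ (K ℕ.* A) ℕ.* (K ℕ.* A)
      regroup = solve-∀ ℕ-ring

    crossing : ∃ λ b → b ℕ.≤ K ℕ.* A × FitsUnder b × ¬ FitsUnder (suc b)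
    crossing = last-before-failure (λ b → ℕ→ℚ (b ℕ.* b) ≤? U * ℕ→ℚ (A ℕ.* A)) (K ℕ.* A)
                 (0≤* 0≤U (0≤ℕ→ℚ (A ℕ.* A))) ¬FitsUnder[1+KA]

  B : ℕ
  B = proj₁ crossing

  B≤KA : B ℕ.≤ K ℕ.* A
  B≤KA = proj₁ (proj₂ crossing)

  B²≤UA² : ℕ→ℚ (B ℕ.* B) ≤ U * ℕ→ℚ (A ℕ.* A)
  B²≤UA² = proj₁ (proj₂ (proj₂ crossing))

  UA²<[1+B]² : U * ℕ→ℚ (A ℕ.* A) < ℕ→ℚ (suc B ℕ.* suc B)
  UA²<[1+B]² = ≰⇒> (proj₂ (proj₂ (proj₂ crossing)))

  2B+1≤2δA² : ℕ→ℚ (2 ℕ.* B ℕ.+ 1) ≤ ℕ→ℚ 2 * δ * ℕ→ℚ (A ℕ.* A)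
  2B+1≤2δA² = begin
    ℕ→ℚ (2 ℕ.* B ℕ.+ 1)                    ≤⟨ ℕ→ℚ-mono-≤ 2B+1≤2c ⟩
    ℕ→ℚ (2 ℕ.* c)                          ≃⟨ ℕ→ℚ-* 2 c ⟩
    ℕ→ℚ 2 * ℕ→ℚ c                          ≃⟨ *-congʳ {ℕ→ℚ c} (*-identityʳ (ℕ→ℚ 2)) ⟨
    ℕ→ℚ 2 * 1ℚᵘ * ℕ→ℚ c                    ≤⟨ *-monoˡ-≤′ (0≤ℕ→ℚ c) (*-monoʳ-≤′ (0≤ℕ→ℚ 2) 1≤γG) ⟩
    ℕ→ℚ 2 * (γ * ℕ→ℚ G) * ℕ→ℚ c            ≃⟨ *-congʳ {ℕ→ℚ c} (*-congˡ {ℕ→ℚ 2} (*-congʳ {ℕ→ℚ G} δ*4[1+K]≃γ)) ⟨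
    ℕ→ℚ 2 * (δ * F * ℕ→ℚ G) * ℕ→ℚ c        ≃⟨ regroup (ℕ→ℚ 2) δ F (ℕ→ℚ G) (ℕ→ℚ c) ⟩
    ℕ→ℚ 2 * δ * (F * (ℕ→ℚ G * ℕ→ℚ c))      ≃⟨ *-congˡ {ℕ→ℚ 2 * δ} (≃-trans (ℕ→ℚ-* (4 ℕ.* suc K) (G ℕ.* c)) (*-congˡ {F} (ℕ→ℚ-* G c))) ⟨
    ℕ→ℚ 2 * δ * ℕ→ℚ (4 ℕ.* suc K ℕ.* (G ℕ.* c)) ≡⟨ cong (λ n → ℕ→ℚ 2 * δ * ℕ→ℚ n) (A²≡ (4 ℕ.* suc K) G (2 ℕ.* K ℕ.+ 1)) ⟨
    ℕ→ℚ 2 * δ * ℕ→ℚ (A ℕ.* A)              ∎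
    where
    open ≤-Reasoning
    c = (2 ℕ.* K ℕ.+ 1) ℕ.* A
    F = ℕ→ℚ (4 ℕ.* suc K)
    2B+1≤2c : 2 ℕ.* B ℕ.+ 1 ℕ.≤ 2 ℕ.* c
    2B+1≤2c = ℕ.≤-trans (ℕ.+-mono-≤ (ℕ.*-monoʳ-≤ 2 B≤KA) (ℕ.≤-trans 1≤A (ℕ.m≤n+m A (2 ℕ.* K ℕ.* A ℕ.+ A))))
                        (ℕ.≤-reflexive (expand K A))
      where
      expand : ∀ K A → 2 ℕ.* (K ℕ.* A) ℕ.+ (2 ℕ.* K ℕ.* A ℕ.+ A ℕ.+ A) ≡ 2 ℕ.* ((2 ℕ.* K ℕ.+ 1) ℕ.* A)
      expand = solve-∀ ℕ-ring
    regroup : ∀ t d f g c → t * (d * f * g) * c ≃ t * d * (f * (g * c))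
    regroup = solve-∀ ℚᵘ-ring
    A²≡ : ∀ f g k → (k ℕ.* (f ℕ.* g)) ℕ.* (k ℕ.* (f ℕ.* g)) ≡ f ℕ.* (g ℕ.* (k ℕ.* (k ℕ.* (f ℕ.* g))))
    A²≡ = solve-∀ ℕ-ring

  [U-2δ]A²≤B² : (U - ℕ→ℚ 2 * δ) * ℕ→ℚ (A ℕ.* A) ≤ ℕ→ℚ (B ℕ.* B)
  [U-2δ]A²≤B² = begin
    (U - ℕ→ℚ 2 * δ) * ℕ→ℚ (A ℕ.* A)                   ≃⟨ distrib U (ℕ→ℚ 2 * δ) (ℕ→ℚ (A ℕ.* A)) ⟩
    U * ℕ→ℚ (A ℕ.* A) - ℕ→ℚ 2 * δ * ℕ→ℚ (A ℕ.* A)     ≤⟨ +-mono-≤ (<⇒≤ UA²<[1+B]²) (neg-mono-≤ 2B+1≤2δA²) ⟩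
    ℕ→ℚ (suc B ℕ.* suc B) - ℕ→ℚ (2 ℕ.* B ℕ.+ 1)      ≡⟨ cong (λ n → ℕ→ℚ n - ℕ→ℚ (2 ℕ.* B ℕ.+ 1)) (square B) ⟩
    ℕ→ℚ (B ℕ.* B ℕ.+ (2 ℕ.* B ℕ.+ 1)) - ℕ→ℚ (2 ℕ.* B ℕ.+ 1)
                                                      ≃⟨ +-congˡ (- ℕ→ℚ (2 ℕ.* B ℕ.+ 1)) (ℕ→ℚ-+ (B ℕ.* B) _) ⟩
    (ℕ→ℚ (B ℕ.* B) + ℕ→ℚ (2 ℕ.* B ℕ.+ 1)) - ℕ→ℚ (2 ℕ.* B ℕ.+ 1) ≃⟨ cancel (ℕ→ℚ (B ℕ.* B)) (ℕ→ℚ (2 ℕ.* B ℕ.+ 1)) ⟩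
    ℕ→ℚ (B ℕ.* B)                                     ∎
    where
    open ≤-Reasoning
    distrib : ∀ U d a → (U - d) * a ≃ U * a - d * a
    distrib = solve-∀ ℚᵘ-ring
    cancel : ∀ b c → (b + c) - c ≃ b
    cancel = solve-∀ ℚᵘ-ring
    square : ∀ B → suc B ℕ.* suc B ≡ B ℕ.* B ℕ.+ (2 ℕ.* B ℕ.+ 1)
    square = solve-∀ ℕ-ring

  2A²≤B² : 2 ℕ.* (A ℕ.* A) ℕ.≤ B ℕ.* B
  2A²≤B² = ℕ→ℚ-cancel-≤ (begin
    ℕ→ℚ (2 ℕ.* (A ℕ.* A))           ≃⟨ ℕ→ℚ-* 2 (A ℕ.* A) ⟩
    ℕ→ℚ 2 * ℕ→ℚ (A ℕ.* A)           ≤⟨ *-monoˡ-≤′ (0≤ℕ→ℚ (A ℕ.* A)) 2≤U-2δ ⟩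
    (U - ℕ→ℚ 2 * δ) * ℕ→ℚ (A ℕ.* A) ≤⟨ [U-2δ]A²≤B² ⟩
    ℕ→ℚ (B ℕ.* B)                   ∎)
    where
    open ≤-Reasoning
    2≤U-2δ : ℕ→ℚ 2 ≤ U - ℕ→ℚ 2 * δ
    2≤U-2δ = p+q≤r⇒p≤r-q (≤-trans (+-monoʳ-≤ (ℕ→ℚ 2) (≤-trans (*-monoʳ-≤′ (0≤ℕ→ℚ 2) δ≤1) (≤-reflexive (*-identityʳ (ℕ→ℚ 2)))))
                                  (≤-trans (ℕ→ℚ-mono-≤ (ℕ.s≤s (ℕ.s≤s (ℕ.s≤s (ℕ.s≤s ℕ.z≤n))))) (5≤e²upper m)))

  A<B : A ℕ.< B
  A<B = ℕ.≰⇒> λ B≤A → ℕ.<-irrefl refl (ℕ.<-≤-trans (ℕ.<-≤-trans A²<2A² 2A²≤B²) (ℕ.*-mono-≤ B≤A B≤A))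
    where
    A²<2A² : A ℕ.* A ℕ.< 2 ℕ.* (A ℕ.* A)
    A²<2A² = ℕ.<-≤-trans (ℕ.m<m+n (A ℕ.* A) (ℕ.*-mono-≤ 1≤A 1≤A)) (ℕ.≤-reflexive (cong (A ℕ.* A ℕ.+_) (sym (ℕ.+-identityʳ (A ℕ.* A)))))

  u : ℕ
  u = B ∸ A

  B≡A+u : B ≡ A ℕ.+ u
  B≡A+u = sym (ℕ.m+[n∸m]≡n (ℕ.<⇒≤ A<B))

  A²≤2Au+u² : A ℕ.* A ℕ.≤ 2 ℕ.* A ℕ.* u ℕ.+ u ℕ.* u
  A²≤2Au+u² = ℕ.+-cancelˡ-≤ (A ℕ.* A) _ _ (ℕ.≤-trans (ℕ.≤-reflexive (cong (A ℕ.* A ℕ.+_) (sym (ℕ.+-identityʳ (A ℕ.* A)))))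
                (ℕ.≤-trans 2A²≤B² (ℕ.≤-reflexive (trans (cong (λ b → b ℕ.* b) B≡A+u) (square A u)))))
    where
    square : ∀ A u → (A ℕ.+ u) ℕ.* (A ℕ.+ u) ≡ A ℕ.* A ℕ.+ (2 ℕ.* A ℕ.* u ℕ.+ u ℕ.* u)
    square = solve-∀ ℕ-ring

  w : ℕ
  w = (2 ℕ.* A ℕ.* u ℕ.+ u ℕ.* u) ∸ (A ℕ.* A)

  A²+w≡2Au+u² : A ℕ.* A ℕ.+ w ≡ 2 ℕ.* A ℕ.* u ℕ.+ u ℕ.* u
  A²+w≡2Au+u² = ℕ.m+[n∸m]≡n A²≤2Au+u²

  open Shape A u using (D; V; P₁)

  -- Since B² ≤ U A², the ratio V / D = (B² - A²) / (B² + A²) is at most (U - 1) / (U + 1) < 2q.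
  coefficient≤ : ℕ→ℚ 2 * δ * ℕ→ℚ D + ℕ→ℚ 2 * ℕ→ℚ V ≤ ℕ→ℚ 4 * q * ℕ→ℚ D - γ
  coefficient≤ = begin
    ℕ→ℚ 2 * δ * Dq + ℕ→ℚ 2 * Vq              ≤⟨ +-mono-≤ 2δD≤γa 2V≤ ⟩
    γ * a + (ℕ→ℚ 4 * q * Dq - ℕ→ℚ 2 * γ * a)  ≃⟨ collect γ a q Dq ⟩
    ℕ→ℚ 4 * q * Dq - γ * a                   ≤⟨ +-monoʳ-≤ (ℕ→ℚ 4 * q * Dq) (neg-mono-≤ γ≤γa) ⟩
    ℕ→ℚ 4 * q * Dq - γ                       ∎
    where
    open ≤-Reasoning
    a = ℕ→ℚ (A ℕ.* A)
    b = ℕ→ℚ ((A ℕ.+ u) ℕ.* (A ℕ.+ u))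
    Dq = ℕ→ℚ D
    Vq = ℕ→ℚ V
    collect : ∀ g a q d → g * a + (ℕ→ℚ 4 * q * d - ℕ→ℚ 2 * g * a) ≃ ℕ→ℚ 4 * q * d - g * a
    collect = solve-∀ ℚᵘ-ring
    b≤Ua : b ≤ U * a
    b≤Ua = subst (λ B → ℕ→ℚ (B ℕ.* B) ≤ U * a) B≡A+u B²≤UA²
    Dq≃a+b : Dq ≃ a + b
    Dq≃a+b = ℕ→ℚ-+ (A ℕ.* A) _
    Vq≃b-a : Vq ≃ b - a
    Vq≃b-a = ≃-trans (cancel Vq a) (+-congˡ (- a) (≃-sym (≃-trans (≃-reflexive (cong ℕ→ℚ (square A u))) (ℕ→ℚ-+ (A ℕ.* A) V))))
      where
      cancel : ∀ v a → v ≃ (a + v) - a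
      cancel = solve-∀ ℚᵘ-ring
      square : ∀ A u → (A ℕ.+ u) ℕ.* (A ℕ.+ u) ≡ A ℕ.* A ℕ.+ (2 ℕ.* A ℕ.* u ℕ.+ u ℕ.* u)
      square = solve-∀ ℕ-ring
    2V≤ : ℕ→ℚ 2 * Vq ≤ ℕ→ℚ 4 * q * Dq - ℕ→ℚ 2 * γ * a
    2V≤ = p-q≤0⇒p≤q (≤-trans (≤-reflexive (≃-trans (+-cong (*-congˡ {ℕ→ℚ 2} Vq≃b-a)
                                                          (-‿cong (+-congˡ (- (ℕ→ℚ 2 * γ * a)) (*-congˡ {ℕ→ℚ 4 * q} Dq≃a+b))))
                                                  (identity q a b U)))
                              (neg-mono-≤ (0≤* (0≤* (0≤ℕ→ℚ 2) (p≤q⇒0≤q-p 2q≤1)) (p≤q⇒0≤q-p b≤Ua))))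
      where
      identity : ∀ q a b U → ℕ→ℚ 2 * (b - a) - (ℕ→ℚ 4 * q * (a + b) - ℕ→ℚ 2 * ((ℕ→ℚ 2 * q) * (U + 1ℚᵘ) - (U - 1ℚᵘ)) * a)
                             ≃ - (ℕ→ℚ 2 * (1ℚᵘ - ℕ→ℚ 2 * q) * (U * a - b))
      identity = solve-∀ ℚᵘ-ring
    2δD≤γa : ℕ→ℚ 2 * δ * Dq ≤ γ * a
    2δD≤γa = begin
      ℕ→ℚ 2 * δ * Dq                ≤⟨ *-monoˡ-≤′ (0≤ℕ→ℚ D) (*-monoˡ-≤′ 0≤δ (ℕ→ℚ-mono-≤ (ℕ.m≤n+m 2 2))) ⟩
      ℕ→ℚ 4 * δ * Dq                ≤⟨ *-monoʳ-≤′ (0≤* (0≤ℕ→ℚ 4) 0≤δ) (≤-trans (≤-reflexive Dq≃a+b) (+-monoʳ-≤ a (≤-trans b≤Ua (*-monoˡ-≤′ (0≤ℕ→ℚ (A ℕ.* A)) U≤K)))) ⟩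
      ℕ→ℚ 4 * δ * (a + ℕ→ℚ K * a)   ≃⟨ regroup δ a (ℕ→ℚ K) ⟩
      δ * (ℕ→ℚ 4 * (1ℚᵘ + ℕ→ℚ K)) * a ≃⟨ *-congʳ {a} (*-congˡ {δ} (≃-trans (ℕ→ℚ-* 4 (suc K)) (*-congˡ {ℕ→ℚ 4} (ℕ→ℚ-+ 1 K)))) ⟨
      δ * ℕ→ℚ (4 ℕ.* suc K) * a     ≃⟨ *-congʳ {a} δ*4[1+K]≃γ ⟩
      γ * a                         ∎
      where
      regroup : ∀ d a k → ℕ→ℚ 4 * d * (a + k * a) ≃ d * (ℕ→ℚ 4 * (1ℚᵘ + k)) * a
      regroup = solve-∀ ℚᵘ-ring
    γ≤γa : γ ≤ γ * a
    γ≤γa = ≤-trans (≤-reflexive (≃-sym (*-identityʳ γ))) (*-monoʳ-≤′ (<⇒≤ 0<γ) (ℕ→ℚ-mono-≤ (ℕ.*-mono-≤ 1≤A 1≤A)))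

  C N₀ : ℕ
  C  = 6 ℕ.* (D ℕ.* D) ℕ.+ 13 ℕ.* D ℕ.+ 8
  N₀ = C ℕ.* G

  private
    1≤D : 1 ℕ.≤ D
    1≤D = ℕ.≤-trans (ℕ.*-mono-≤ 1≤A 1≤A) (ℕ.m≤m+n (A ℕ.* A) _)

    instance
      D≢0 : ℕ.NonZero D
      D≢0 = ℕ.>-nonZero 1≤D

    lower-order≤ : ∀ n t → n ℕ.≤ D ℕ.* t → 1 ℕ.≤ t →
                   2 ℕ.* (2 ℕ.* D ℕ.* n ℕ.+ D ℕ.* D) ℕ.+ (P₁ ℕ.* t ℕ.+ 8) ℕ.≤ C ℕ.* t
    lower-order≤ n t n≤Dt 1≤t = begin
      2 ℕ.* (2 ℕ.* D ℕ.* n ℕ.+ D ℕ.* D) ℕ.+ (P₁ ℕ.* t ℕ.+ 8)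
        ≡⟨ expand D n P₁ t ⟩
      4 ℕ.* D ℕ.* n ℕ.+ 2 ℕ.* (D ℕ.* D) ℕ.* 1 ℕ.+ P₁ ℕ.* t ℕ.+ 8 ℕ.* 1
        ≤⟨ ℕ.+-mono-≤ (ℕ.+-mono-≤ (ℕ.+-mono-≤ (ℕ.*-monoʳ-≤ (4 ℕ.* D) n≤Dt) (ℕ.*-monoʳ-≤ (2 ℕ.* (D ℕ.* D)) 1≤t))
                                  (ℕ.*-monoˡ-≤ t P₁≤13D))
                      (ℕ.*-monoʳ-≤ 8 1≤t) ⟩
      4 ℕ.* D ℕ.* (D ℕ.* t) ℕ.+ 2 ℕ.* (D ℕ.* D) ℕ.* t ℕ.+ 13 ℕ.* D ℕ.* t ℕ.+ 8 ℕ.* t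
        ≡⟨ collect D t ⟩
      C ℕ.* t ∎
      where
      open ℕ.≤-Reasoning
      P₁≤13D : P₁ ℕ.≤ 13 ℕ.* D
      P₁≤13D = ℕ.≤-trans (ℕ.m≤m+n P₁ _) (ℕ.≤-reflexive (sym (split A u)))
        where
        split : ∀ A u → 13 ℕ.* (A ℕ.* A ℕ.+ (A ℕ.+ u) ℕ.* (A ℕ.+ u))
                        ≡ (14 ℕ.* A ℕ.* u ℕ.+ 6 ℕ.* (u ℕ.* u)) ℕ.+ (26 ℕ.* (A ℕ.* A) ℕ.+ 12 ℕ.* A ℕ.* u ℕ.+ 7 ℕ.* (u ℕ.* u))
        split = solve-∀ ℕ-ring
      expand : ∀ D n P t → 2 ℕ.* (2 ℕ.* D ℕ.* n ℕ.+ D ℕ.* D) ℕ.+ (P ℕ.* t ℕ.+ 8)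
                           ≡ 4 ℕ.* D ℕ.* n ℕ.+ 2 ℕ.* (D ℕ.* D) ℕ.* 1 ℕ.+ P ℕ.* t ℕ.+ 8 ℕ.* 1
      expand = solve-∀ ℕ-ring
      collect : ∀ D t → 4 ℕ.* D ℕ.* (D ℕ.* t) ℕ.+ 2 ℕ.* (D ℕ.* D) ℕ.* t ℕ.+ 13 ℕ.* D ℕ.* t ℕ.+ 8 ℕ.* t
                        ≡ (6 ℕ.* (D ℕ.* D) ℕ.+ 13 ℕ.* D ℕ.+ 8) ℕ.* t
      collect = solve-∀ ℕ-ring

  private
    T P : ℕ → ℚᵘ
    T t = ℕ→ℚ (D ℕ.* (t ℕ.* t))
    P t = ℕ→ℚ (P₁ ℕ.* t ℕ.+ 8)

  4cardS≤[4qD-γ]T+P : ∀ {n} t a → 1 ℕ.≤ t → n ℕ.≤ D ℕ.* t → AllPairs ℕ._<_ a → All (λ x → 1 ℕ.≤ x × x ℕ.≤ n) a →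
            ℕ→ℚ (4 ℕ.* cardS a) ≤ (ℕ→ℚ 4 * q * ℕ→ℚ D - γ) * T t + P t
  4cardS≤[4qD-γ]T+P t a 1≤t n≤Dt <a bounds = begin
    ℕ→ℚ (4 ℕ.* cardS a)
      ≤⟨ MainBound.4cardS≤ A u t w 1≤A 1≤t A²+w≡2Au+u² m a n≤Dt <a bounds 0≤δ [U-2δ]A²≤[A+u]² ⟩
    ℕ→ℚ (2 ℕ.* (D ℕ.* D) ℕ.* (t ℕ.* t)) * δ + ℕ→ℚ (2 ℕ.* D ℕ.* V ℕ.* (t ℕ.* t) ℕ.+ P₁ ℕ.* t ℕ.+ 8)
      ≡⟨ cong₂ (λ x y → ℕ→ℚ x * δ + ℕ→ℚ y) (shape₁ D t) (shape₂ D V t (P₁ ℕ.* t)) ⟩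
    ℕ→ℚ (2 ℕ.* D ℕ.* (D ℕ.* (t ℕ.* t))) * δ + ℕ→ℚ (2 ℕ.* V ℕ.* (D ℕ.* (t ℕ.* t)) ℕ.+ (P₁ ℕ.* t ℕ.+ 8))
      ≃⟨ +-cong (*-congʳ {δ} (ℕ→ℚ-*₃ 2 D _)) (≃-trans (ℕ→ℚ-+ (2 ℕ.* V ℕ.* (D ℕ.* (t ℕ.* t))) _) (+-congˡ (P t) (ℕ→ℚ-*₃ 2 V _))) ⟩
    ℕ→ℚ 2 * ℕ→ℚ D * T t * δ + (ℕ→ℚ 2 * ℕ→ℚ V * T t + P t)
      ≃⟨ factor (ℕ→ℚ D) (ℕ→ℚ V) (T t) δ (P t) ⟩
    (ℕ→ℚ 2 * δ * ℕ→ℚ D + ℕ→ℚ 2 * ℕ→ℚ V) * T t + P t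
      ≤⟨ +-monoˡ-≤ (P t) (*-monoˡ-≤′ (0≤ℕ→ℚ (D ℕ.* (t ℕ.* t))) coefficient≤) ⟩
    (ℕ→ℚ 4 * q * ℕ→ℚ D - γ) * T t + P t ∎
    where
    open ≤-Reasoning
    [U-2δ]A²≤[A+u]² : (U - ℕ→ℚ 2 * δ) * ℕ→ℚ (A ℕ.* A) ≤ ℕ→ℚ ((A ℕ.+ u) ℕ.* (A ℕ.+ u))
    [U-2δ]A²≤[A+u]² = subst (λ B → (U - ℕ→ℚ 2 * δ) * ℕ→ℚ (A ℕ.* A) ≤ ℕ→ℚ (B ℕ.* B)) B≡A+u [U-2δ]A²≤B²
    ℕ→ℚ-*₃ : ∀ a b c → ℕ→ℚ (a ℕ.* b ℕ.* c) ≃ ℕ→ℚ a * ℕ→ℚ b * ℕ→ℚ c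
    ℕ→ℚ-*₃ a b c = ≃-trans (ℕ→ℚ-* (a ℕ.* b) c) (*-congʳ {ℕ→ℚ c} (ℕ→ℚ-* a b))
    shape₁ : ∀ D t → 2 ℕ.* (D ℕ.* D) ℕ.* (t ℕ.* t) ≡ 2 ℕ.* D ℕ.* (D ℕ.* (t ℕ.* t))
    shape₁ = solve-∀ ℕ-ring
    shape₂ : ∀ D V t p → 2 ℕ.* D ℕ.* V ℕ.* (t ℕ.* t) ℕ.+ p ℕ.+ 8 ≡ 2 ℕ.* V ℕ.* (D ℕ.* (t ℕ.* t)) ℕ.+ (p ℕ.+ 8)
    shape₂ = solve-∀ ℕ-ring
    factor : ∀ d v T δ P → ℕ→ℚ 2 * d * T * δ + (ℕ→ℚ 2 * v * T + P) ≃ (ℕ→ℚ 2 * δ * d + ℕ→ℚ 2 * v) * T + P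
    factor = solve-∀ ℚᵘ-ring

  -- Here γ D t² beats the terms of order D n + D² + t that the rounding n ≤ D t ≤ n + D introduces.
  [4qD-γ]T+P≤4qn² : ∀ n t → N₀ ℕ.≤ n → 1 ℕ.≤ t → n ℕ.≤ D ℕ.* t → D ℕ.* t ℕ.≤ n ℕ.+ D →
                    (ℕ→ℚ 4 * q * ℕ→ℚ D - γ) * T t + P t ≤ ℕ→ℚ 4 * q * ℕ→ℚ (n ℕ.* n)
  [4qD-γ]T+P≤4qn² n t N₀≤n 1≤t n≤Dt Dt≤n+D = begin
    (ℕ→ℚ 4 * q * ℕ→ℚ D - γ) * T t + P t
      ≃⟨ regroup (ℕ→ℚ 4 * q) (ℕ→ℚ D) γ (T t) (P t) ⟩
    ℕ→ℚ 4 * q * (ℕ→ℚ D * T t) + (P t - γ * T t)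
      ≤⟨ +-monoˡ-≤ (P t - γ * T t) (*-monoʳ-≤′ (0≤* (0≤ℕ→ℚ 4) 0≤q) [Dt]²≤n²+E) ⟩
    ℕ→ℚ 4 * q * (ℕ→ℚ (n ℕ.* n) + E) + (P t - γ * T t)
      ≃⟨ regroup′ (ℕ→ℚ 4 * q) (ℕ→ℚ (n ℕ.* n)) E (P t) (γ * T t) ⟩
    ℕ→ℚ 4 * q * ℕ→ℚ (n ℕ.* n) + ((ℕ→ℚ 4 * q * E + P t) - γ * T t)
      ≤⟨ +-monoʳ-≤ (ℕ→ℚ 4 * q * ℕ→ℚ (n ℕ.* n)) (+-monoˡ-≤ (- (γ * T t)) lower-order≤γT) ⟩
    ℕ→ℚ 4 * q * ℕ→ℚ (n ℕ.* n) + (γ * T t - γ * T t)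
      ≃⟨ cancel (ℕ→ℚ 4 * q * ℕ→ℚ (n ℕ.* n)) (γ * T t) ⟩
    ℕ→ℚ 4 * q * ℕ→ℚ (n ℕ.* n) ∎
    where
    open ≤-Reasoning
    E : ℚᵘ
    E = ℕ→ℚ (2 ℕ.* D ℕ.* n ℕ.+ D ℕ.* D)
    regroup : ∀ c d g T P → (c * d - g) * T + P ≃ c * (d * T) + (P - g * T)
    regroup = solve-∀ ℚᵘ-ring
    regroup′ : ∀ c x e P y → c * (x + e) + (P - y) ≃ c * x + ((c * e + P) - y)
    regroup′ = solve-∀ ℚᵘ-ring
    cancel : ∀ a y → a + (y - y) ≃ a
    cancel = solve-∀ ℚᵘ-ring
    [Dt]²≤n²+E : ℕ→ℚ D * T t ≤ ℕ→ℚ (n ℕ.* n) + E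
    [Dt]²≤n²+E = begin
      ℕ→ℚ D * T t                                   ≃⟨ ℕ→ℚ-* D (D ℕ.* (t ℕ.* t)) ⟨
      ℕ→ℚ (D ℕ.* (D ℕ.* (t ℕ.* t)))                 ≡⟨ cong ℕ→ℚ (square D t) ⟩
      ℕ→ℚ ((D ℕ.* t) ℕ.* (D ℕ.* t))                 ≤⟨ ℕ→ℚ-mono-≤ (ℕ.*-mono-≤ Dt≤n+D Dt≤n+D) ⟩
      ℕ→ℚ ((n ℕ.+ D) ℕ.* (n ℕ.+ D))                 ≡⟨ cong ℕ→ℚ (square′ n D) ⟩
      ℕ→ℚ (n ℕ.* n ℕ.+ (2 ℕ.* D ℕ.* n ℕ.+ D ℕ.* D)) ≃⟨ ℕ→ℚ-+ (n ℕ.* n) _ ⟩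
      ℕ→ℚ (n ℕ.* n) + E                             ∎
      where
      square : ∀ D t → D ℕ.* (D ℕ.* (t ℕ.* t)) ≡ (D ℕ.* t) ℕ.* (D ℕ.* t)
      square = solve-∀ ℕ-ring
      square′ : ∀ n D → (n ℕ.+ D) ℕ.* (n ℕ.+ D) ≡ n ℕ.* n ℕ.+ (2 ℕ.* D ℕ.* n ℕ.+ D ℕ.* D)
      square′ = solve-∀ ℕ-ring
    C≤γDt : ℕ→ℚ C ≤ γ * ℕ→ℚ (D ℕ.* t)
    C≤γDt = begin
      ℕ→ℚ C                       ≃⟨ *-identityʳ (ℕ→ℚ C) ⟨
      ℕ→ℚ C * 1ℚᵘ                 ≤⟨ *-monoʳ-≤′ (0≤ℕ→ℚ C) 1≤γG ⟩
      ℕ→ℚ C * (γ * ℕ→ℚ G)         ≃⟨ swap (ℕ→ℚ C) γ (ℕ→ℚ G) ⟩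
      γ * (ℕ→ℚ C * ℕ→ℚ G)         ≃⟨ *-congˡ {γ} (ℕ→ℚ-* C G) ⟨
      γ * ℕ→ℚ N₀                  ≤⟨ *-monoʳ-≤′ (<⇒≤ 0<γ) (ℕ→ℚ-mono-≤ (ℕ.≤-trans N₀≤n n≤Dt)) ⟩
      γ * ℕ→ℚ (D ℕ.* t)           ∎
      where
      swap : ∀ c g G → c * (g * G) ≃ g * (c * G)
      swap = solve-∀ ℚᵘ-ring
    lower-order≤γT : ℕ→ℚ 4 * q * E + P t ≤ γ * T t
    lower-order≤γT = begin
      ℕ→ℚ 4 * q * E + P t          ≤⟨ +-monoˡ-≤ (P t) (*-monoˡ-≤′ (0≤ℕ→ℚ _) 4q≤2) ⟩
      ℕ→ℚ 2 * E + P t              ≃⟨ +-congˡ (P t) (ℕ→ℚ-* 2 (2 ℕ.* D ℕ.* n ℕ.+ D ℕ.* D)) ⟨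
      ℕ→ℚ (2 ℕ.* (2 ℕ.* D ℕ.* n ℕ.+ D ℕ.* D)) + P t ≃⟨ ℕ→ℚ-+ (2 ℕ.* (2 ℕ.* D ℕ.* n ℕ.+ D ℕ.* D)) _ ⟨
      ℕ→ℚ (2 ℕ.* (2 ℕ.* D ℕ.* n ℕ.+ D ℕ.* D) ℕ.+ (P₁ ℕ.* t ℕ.+ 8))
                                   ≤⟨ ℕ→ℚ-mono-≤ (lower-order≤ n t n≤Dt 1≤t) ⟩
      ℕ→ℚ (C ℕ.* t)                ≃⟨ ℕ→ℚ-* C t ⟩
      ℕ→ℚ C * ℕ→ℚ t                ≤⟨ *-monoˡ-≤′ (0≤ℕ→ℚ t) C≤γDt ⟩
      γ * ℕ→ℚ (D ℕ.* t) * ℕ→ℚ t    ≃⟨ *-assoc γ (ℕ→ℚ (D ℕ.* t)) (ℕ→ℚ t) ⟩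
      γ * (ℕ→ℚ (D ℕ.* t) * ℕ→ℚ t)  ≃⟨ *-congˡ {γ} (ℕ→ℚ-* (D ℕ.* t) t) ⟨
      γ * ℕ→ℚ (D ℕ.* t ℕ.* t)      ≡⟨ cong (λ k → γ * ℕ→ℚ k) (ℕ.*-assoc D t t) ⟩
      γ * T t                      ∎
      where
      4q≤2 : ℕ→ℚ 4 * q ≤ ℕ→ℚ 2
      4q≤2 = ≤-trans (≤-reflexive (double q)) (≤-trans (*-monoʳ-≤′ (0≤ℕ→ℚ 2) 2q≤1) (≤-reflexive (*-identityʳ (ℕ→ℚ 2))))
        where
        double : ∀ q → ℕ→ℚ 4 * q ≃ ℕ→ℚ 2 * (ℕ→ℚ 2 * q)
        double = solve-∀ ℚᵘ-ring

  cardS≤qn² : ∀ {n} a → N₀ ℕ.≤ n → AllPairs ℕ._<_ a → All (λ x → 1 ℕ.≤ x × x ℕ.≤ n) a →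
              ℕ→ℚ (cardS a) ≤ q * ℕ→ℚ (n ℕ.^ 2)
  cardS≤qn² {n} a N₀≤n <a bounds = *-cancelˡ-≤′ {ℕ→ℚ 4} (0<ℕ→ℚ (ℕ.s≤s ℕ.z≤n)) (begin
    ℕ→ℚ 4 * ℕ→ℚ (cardS a)                  ≃⟨ ℕ→ℚ-* 4 (cardS a) ⟨
    ℕ→ℚ (4 ℕ.* cardS a)                    ≤⟨ 4cardS≤[4qD-γ]T+P t a 1≤t n≤Dt <a bounds ⟩
    (ℕ→ℚ 4 * q * ℕ→ℚ D - γ) * T t + P t    ≤⟨ [4qD-γ]T+P≤4qn² n t N₀≤n 1≤t n≤Dt Dt≤n+D ⟩
    ℕ→ℚ 4 * q * ℕ→ℚ (n ℕ.* n)              ≃⟨ *-assoc (ℕ→ℚ 4) q (ℕ→ℚ (n ℕ.* n)) ⟩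
    ℕ→ℚ 4 * (q * ℕ→ℚ (n ℕ.* n))            ≡⟨ cong (λ k → ℕ→ℚ 4 * (q * ℕ→ℚ (n ℕ.* k))) (ℕ.*-identityʳ n) ⟨
    ℕ→ℚ 4 * (q * ℕ→ℚ (n ℕ.^ 2))            ∎)
    where
    open ≤-Reasoning
    t = n div D ℕ.+ 1
    1≤t : 1 ℕ.≤ t
    1≤t = ℕ.m≤n+m 1 (n div D)
    Dt≡ : D ℕ.* t ≡ n div D ℕ.* D ℕ.+ D
    Dt≡ = trans (ℕ.*-distribˡ-+ D (n div D) 1) (cong₂ ℕ._+_ (ℕ.*-comm D (n div D)) (ℕ.*-identityʳ D))
    n≤Dt : n ℕ.≤ D ℕ.* t
    n≤Dt = ℕ.≤-trans (ℕ.≤-reflexive (m≡m%n+[m/n]*n n D))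
             (ℕ.≤-trans (ℕ.+-monoˡ-≤ _ (ℕ.<⇒≤ (m%n<n n D))) (ℕ.≤-reflexive (trans (ℕ.+-comm D _) (sym Dt≡))))
    Dt≤n+D : D ℕ.* t ℕ.≤ n ℕ.+ D
    Dt≤n+D = ℕ.≤-trans (ℕ.≤-reflexive Dt≡) (ℕ.+-monoˡ-≤ D (m/n*n≤m n D))

open import Data.List.Base using (List)
open import Data.List.Relation.Unary.All using (All)
open import Data.List.Relation.Unary.AllPairs using (AllPairs)
open import Data.Nat.Base using (_≤_; _<_; _^_)
open import Data.Rational.Unnormalised.Base using (_*_)
open import Data.Rational.Unnormalised.Properties using (_≤?_; ≤-refl; ≤-trans; ≰⇒≥)
open Rational using (*-monoˡ-≤′; 0≤ℕ→ℚ)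
open Exponential using (c₄<½)

proposition1p4 : (q : ℚᵘ) → c₄< q →
  ∃ λ N → (n : ℕ) → N ≤ n → 1 ≤ n →
    (a : List ℕ) → AllPairs _<_ a → All (λ x → 1 ≤ x × x ≤ n) a →
    ℕ→ℚ (cardS a) Q.≤ q * ℕ→ℚ (n ^ 2)
proposition1p4 q c₄<q with q ≤? Q.½
... | yes q≤½ = N₀ , λ n N₀≤n _ a → cardS≤qn² a N₀≤n
  where open ParameterChoice q q≤½ c₄<q
... | no  q≰½ = N₀ , λ n N₀≤n _ a <a bounds →
                  ≤-trans (cardS≤qn² a N₀≤n <a bounds) (*-monoˡ-≤′ (0≤ℕ→ℚ (n ^ 2)) (≰⇒≥ q≰½))
  where open ParameterChoice Q.½ ≤-refl c₄<½
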